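{- Fix $k\in\mathbb Z_{\ge0}$ and an irreducible fraction $t\in(0,1)$. Then the Hirzebruch–Jung continued fraction expansion of $\dfrac{m_{k,t}}{u^+_{k,t}}$ is a $k$-Wahl chain.
   Context: Farey tree $\mathrm{F}\mathbb T$: root $\left(\frac01,\frac11,\frac10\right)$; vertex $\left(\frac ab,\frac cd,\frac ef\right)$ has left child $\left(\frac ab,\frac{a+c}{b+d},\frac cd\right)$ and right child $\left(\frac cd,\frac{c+e}{d+f},\frac ef\right)$. $\mathrm{M}\mathbb T(k)$: root $(1,k+2,1)$; vertex $(a,b,c)$ has left child $\left(a,\frac{a^2+kab+b^2}{c},b\right)$ and right child $\left(b,\frac{b^2+kbc+c^2}{a},c\right)$. Let $\theta\colon\mathrm{F}\mathbb T\to\mathrm{M}\mathbb T(k)$ be the bijection preserving root and left/right children. For irreducible $t\in(0,1)$ let $(r,t,s)$ be the vertex of $\mathrm{F}\mathbb T$ with middle entry $t$, $(m_r,m_t,m_s)=\theta(r,t,s)$, $m_{k,t}:=m_t$, and $u^+_{k,t}$ the unique $x\in(0,m_t)$ with $m_rx\equiv m_s\pmod{m_t}$. Every rational $x>1$ has a unique Hirzebruch–Jung expansion $x=[[b_1,\dots,b_s]]:=b_1-\cfrac1{b_2-\cfrac1{\ddots-\cfrac1{b_s}}}$ with integers $b_i\ge2$. $k$-Wahl chains are defined recursively: $[[k+2]]$ is a $k$-Wahl chain; if $[[b_1,\dots,b_\ell]]$ is a $k$-Wahl chain, so are $[[b_1+1,b_2,\dots,b_\ell,2]]$ and $[[2,b_1,\dots,b_{\ell-1},b_\ell+1]]$.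 -}

module Defs where

open import Data.Nat using (ℕ; zero; suc; _+_; _*_; _∸_; _/_)
open import Data.Product using (_×_; _,_)
open import Data.List using (List; []; _∷_; _++_)

-- Directions in a binary tree; a vertex is given by its path from the root.
data Dir : Set where
  L R : Dir

walk : {A : Set} → (Dir → A → A) → A → List Dir → A
walk step v []      = v
walk step v (d ∷ p) = walk step (step d v) p

-- Farey tree FT.  A fraction a/b is stored as the pair (a , b);
-- 1/0 is (1 , 0).

Frac : Set
Frac = ℕ × ℕ

mediant : Frac → Frac → Frac
mediant (a , b) (c , d) = (a + c , b + d)

FTriple : Set
FTriple = Frac × Frac × Frac

fareyStep : Dir → FTriple → FTriple
fareyStep L (x , y , z) = (x , mediant x y , y)
fareyStep R (x , y , z) = (y , mediant y z , z)

fareyRoot : FTriple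
fareyRoot = ((0 , 1) , (1 , 1) , (1 , 0))

farey : List Dir → FTriple
farey = walk fareyStep fareyRoot

-- Markov-type tree MT(k).  The divisions below are exact (a standard
-- fact); the zero-divisor guard never fires since all entries are ≥ 1.

divN : ℕ → ℕ → ℕ
divN n zero    = 0
divN n (suc c) = n / suc c

MTriple : Set
MTriple = ℕ × ℕ × ℕ

markovStep : ℕ → Dir → MTriple → MTriple
markovStep k L (a , b , c) = (a , divN (a * a + k * a * b + b * b) c , b)
markovStep k R (a , b , c) = (b , divN (b * b + k * b * c + c * c) a , c)

markovRoot : ℕ → MTriple
markovRoot k = (1 , k + 2 , 1)

-- θ sends the Farey vertex at path p to the MT(k) vertex at path p.
markov : ℕ → List Dir → MTriple
markov k = walk (markovStep k) (markovRoot k)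

-- Hirzebruch–Jung continued fractions.
-- hjEval (b₁ ∷ … ∷ bₛ) = (numerator , denominator) of [[b₁,…,bₛ]].

hjEval : List ℕ → ℕ × ℕ
hjEval []       = (1 , 0)
hjEval (b ∷ []) = (b , 1)
hjEval (b ∷ bs@(_ ∷ _)) with hjEval bs
... | (n , d) = (b * n ∸ d , n)

open import Data.List.Relation.Unary.All using (All)
open import Data.Nat using (_≤_; _<_)
open import Relation.Binary.PropositionalEquality using (_≡_)

data IsHJExpansion (m u : ℕ) : List ℕ → Set where
  hj : ∀ {b bs} → All (2 ≤_) (b ∷ bs) →
       (let (n , d) = hjEval (b ∷ bs) in m * d ≡ u * n) →
       IsHJExpansion m u (b ∷ bs)

data KWahl (k : ℕ) : List ℕ → Set where
  base  : KWahl k ((k + 2) ∷ [])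
  stepL : ∀ {b bs} → KWahl k (b ∷ bs) → KWahl k (suc b ∷ (bs ++ (2 ∷ [])))
  stepR : ∀ {bs b} → KWahl k (bs ++ (b ∷ [])) → KWahl k (2 ∷ (bs ++ (suc b ∷ [])))

open import Data.Integer using (ℤ; +_; _-_)
open import Data.Integer.Divisibility using (_∣_)

_≡_[mod_] : ℕ → ℕ → ℕ → Set
a ≡ b [mod n ] = (+ n) ∣ ((+ a) - (+ b))

module Submission where

open import Data.Empty using (⊥; ⊥-elim)
open import Data.Integer
  using (ℤ; +_; -[1+_]; -_; _+_; _*_; _-_; 0ℤ; 1ℤ; -1ℤ; +≤+; ∣_∣; ≢-nonZero)
  renaming (_≤_ to _≤ℤ_)
import Data.Integer.Properties as ℤ
import Data.Integer.Divisibility.Signed as Signed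
open import Data.Integer.Tactic.RingSolver using (solve; solve-∀)
open import Data.List using (List; []; _∷_; _∷ʳ_; length; initLast; _∷ʳ′_)
open import Data.List.Properties using (length-++)
import Data.List.Relation.Unary.All as All
open import Data.List.Relation.Unary.All using (All)
open import Data.List.Relation.Unary.All.Properties using (∷ʳ⁻; ∷ʳ⁺)
open import Data.Nat using (ℕ; zero; suc; _≤_; _<_; s≤s; z≤n; _/_)
import Data.Nat as ℕ
import Data.Nat.Properties as ℕ
open import Data.Nat.Coprimality using (Coprime)
open import Data.Nat.DivMod using (m*n/n≡m)
open import Data.Nat.Induction using (<-wellFounded)
import Data.Nat.Tactic.RingSolver as ℕ-Solver
open import Data.Product using (∃-syntax; _,_; _×_; proj₁; proj₂)
open import Data.Sum using (_⊎_; inj₁; inj₂)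
open import Induction.WellFounded using (Acc; acc)
open import Relation.Binary.PropositionalEquality
open import Defs

-- Let Q = x² − kxy + y² be the norm form of ℤ[ω], ω² + kω + 1 = 0, and let p/q = [[b₁,…,bₗ]],
-- p′/q′ = [[b₁,…,bₗ₋₁]]. Call the chain certified if p′ + q + k = p and Q reads
-- p X² + (2q + k) XY + (q − q′) Y² in some basis (e₁, e₂) of ℤ[ω] of determinant −1.
--
-- Certified chains are k-Wahl, by induction on the length. Put A = p − 2q and B = p − 2p′, so
-- A + B = 2k, A < 0 iff b₁ = 2 and B < 0 iff bₗ = 2. Ends (≥3, 2) and (2, ≥3) undo a Wahl step
-- by a change of basis; ends (2, 2) contradict A + B ≥ 0; for ends (≥3, ≥3), p·Q(e₁ − 2e₂) =
-- 4 − AB excludes a positive value, Vieta jumping shows that a value −n ≤ 0 at a primitive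
-- vector needs k ≤ n + 2, which the sizes forbid unless k = 2 and Q(e₁ − 2e₂) = 0, and then p = 4.
--
-- Every triple (a, b, c) of MT(k) satisfies a² + b² + c² + k(ab + bc + ca) = 3(k + 1)abc and each
-- entry is a norm N(α) with conj α dividing the matching one of c − bω, a − cω, b − aω; Vieta
-- flips preserve this. If au ≡ c mod b and b = N(α), Bézout for (a, b) gives α ∣ u − ω, and the
-- basis (conj α, (u − ω)/α) certifies the expansion of b/u.

-- Order facts carry their gap as a natural number, so that deriving one inequality from others
-- is a ring identity between gaps.
NonNeg : ℤ → Set
NonNeg x = ∃[ n ] x ≡ + n

infix 4 _≼_ _≺_
_≼_ _≺_ : ℤ → ℤ → Set
i ≼ j = NonNeg (j - i)
i ≺ j = NonNeg (j - i - 1ℤ)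

+-nonNeg : ∀ n → NonNeg (+ n)
+-nonNeg n = n , refl

nonNeg-+ : ∀ {x y} → NonNeg x → NonNeg y → NonNeg (x + y)
nonNeg-+ (m , refl) (n , refl) = m ℕ.+ n , sym (ℤ.pos-+ m n)

nonNeg-* : ∀ {x y} → NonNeg x → NonNeg y → NonNeg (x * y)
nonNeg-* (m , refl) (n , refl) = m ℕ.* n , sym (ℤ.pos-* m n)

nonNeg-by : ∀ x {y} → NonNeg y → x ≡ y → NonNeg x
nonNeg-by x h refl = h

≼-by : ∀ i j {y} → NonNeg y → j - i ≡ y → i ≼ j
≼-by i j = nonNeg-by (j - i)

≺-by : ∀ i j {y} → NonNeg y → j - i - 1ℤ ≡ y → i ≺ j
≺-by i j = nonNeg-by (j - i - 1ℤ)

infixl 7 _⊛_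
infixl 6 _⊞_

_⊛_ : ∀ {l r} (c : ℤ) → l ≡ r → c * l ≡ c * r
c ⊛ h = cong (c *_) h

_⊞_ : ∀ {l₁ r₁ l₂ r₂} → l₁ ≡ r₁ → l₂ ≡ r₂ → l₁ + l₂ ≡ r₁ + r₂
_⊞_ = cong₂ _+_

linear-combination : ∀ x y {l r} → l ≡ r → x ≡ y + (l - r) → x ≡ y
linear-combination x y {l} refl eq = trans eq (cancel y l)
  where
  cancel : ∀ y l → y + (l - l) ≡ y
  cancel = solve-∀

nonNeg-via : ∀ x {y l r} → NonNeg y → l ≡ r → x ≡ y + (l - r) → NonNeg x
nonNeg-via x h eq identity = nonNeg-by x h (linear-combination x _ eq identity)

nonNeg+1≢0 : ∀ {t} → NonNeg t → t + 1ℤ ≢ 0ℤ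
nonNeg+1≢0 (n , refl) eq with trans (ℕ.+-comm 1 n) (ℤ.+-injective eq)
... | ()

nonNeg-contradiction : ∀ {t l r} → NonNeg t → l ≡ r → t + 1ℤ ≡ l - r → ⊥
nonNeg-contradiction {l = l} h refl eq = nonNeg+1≢0 h (trans eq (ℤ.+-inverseʳ l))

nonNeg-sum-zero : ∀ {a b l r} → NonNeg a → NonNeg b → l ≡ r → a + b ≡ l - r → a ≡ 0ℤ
nonNeg-sum-zero {l = l} (i , refl) (j , refl) refl eq =
  cong +_ (ℕ.m+n≡0⇒m≡0 i (ℤ.+-injective (trans eq (ℤ.+-inverseʳ l))))

square-nonNeg : ∀ x → NonNeg (x * x)
square-nonNeg (+ n)    = n ℕ.* n , sym (ℤ.pos-* n n)
square-nonNeg -[1+ n ] = suc n ℕ.* suc n , refl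

square≡0⇒≡0 : ∀ x → x * x ≡ 0ℤ → x ≡ 0ℤ
square≡0⇒≡0 x eq with ℤ.i*j≡0⇒i≡0∨j≡0 x eq
... | inj₁ x≡0 = x≡0
... | inj₂ x≡0 = x≡0

∣∣≡1⇒±1 : ∀ s → ∣ s ∣ ≡ 1 → s ≡ 1ℤ ⊎ s ≡ -1ℤ
∣∣≡1⇒±1 (+ 1)           _ = inj₁ refl
∣∣≡1⇒±1 -[1+ 0 ]        _ = inj₂ refl
∣∣≡1⇒±1 (+ 0)           ()
∣∣≡1⇒±1 (+ suc (suc n)) ()
∣∣≡1⇒±1 -[1+ suc n ]    ()

unit-square : ∀ a b → a * b ≡ -1ℤ → b * b ≡ 1ℤ
unit-square a b eq =
  by-unit (∣∣≡1⇒±1 b (ℕ.m*n≡1⇒n≡1 ∣ a ∣ ∣ b ∣ (trans (sym (ℤ.abs-* a b)) (cong ∣_∣ eq))))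
  where
  by-unit : b ≡ 1ℤ ⊎ b ≡ -1ℤ → b * b ≡ 1ℤ
  by-unit (inj₁ refl) = refl
  by-unit (inj₂ refl) = refl

negate-gap : ∀ x y d → y - x ≡ d → x - y - 1ℤ ≡ - d - 1ℤ
negate-gap x y d eq = linear-combination (x - y - 1ℤ) (- d - 1ℤ) (-1ℤ ⊛ eq) (solve (x ∷ y ∷ d ∷ []))

≼-total : ∀ x y → x ≼ y ⊎ y ≺ x
≼-total x y = by-difference (y - x) refl
  where
  by-difference : ∀ d → y - x ≡ d → x ≼ y ⊎ y ≺ x
  by-difference (+ n)    eq = inj₁ (n , eq)
  by-difference -[1+ n ] eq = inj₂ (n , negate-gap x y -[1+ n ] eq)

trichotomy : ∀ x → 0ℤ ≺ x ⊎ x ≡ 0ℤ ⊎ x ≺ 0ℤ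
trichotomy (+ zero)  = inj₂ (inj₁ refl)
trichotomy (+ suc n) = inj₁ (n , shift (+ n))
  where
  shift : ∀ m → (1ℤ + m) - 0ℤ - 1ℤ ≡ m
  shift m = solve (m ∷ [])
trichotomy -[1+ n ]  = inj₂ (inj₂ (n , refl))

≺-+-comm : ∀ {x y z} → x + y ≺ z → y + x ≺ z
≺-+-comm {x} {y} {z} h = ≺-by (y + x) z h (solve (x ∷ y ∷ z ∷ []))

≺⇒≼ : ∀ {x y} → x ≺ y → x ≼ y
≺⇒≼ {x} {y} h = ≼-by x y (nonNeg-+ h (1 , refl)) (solve (x ∷ y ∷ []))

ℕ≤⇒≼ : ∀ {m n} → m ≤ n → + m ≼ + n
ℕ≤⇒≼ {m} {n} m≤n = n ℕ.∸ m , trans (ℤ.m-n≡m⊖n n m) (ℤ.⊖-≥ m≤n)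

ℕ<⇒≺ : ∀ {m n} → m < n → + m ≺ + n
ℕ<⇒≺ {m} {n} m<n = nonNeg-by (+ n - + m - 1ℤ) (ℕ≤⇒≼ m<n) (shift (+ n) (+ m))
  where
  shift : ∀ x y → x - y - 1ℤ ≡ x - (1ℤ + y)
  shift x y = solve (x ∷ y ∷ [])

≼⇒ℕ≤ : ∀ {m n} → + m ≼ + n → m ≤ n
≼⇒ℕ≤ (t , eq) = ℤ.drop‿+≤+ (ℤ.0≤i-j⇒j≤i (subst (0ℤ ≤ℤ_) (sym eq) (+≤+ z≤n)))

≺⇒ℕ< : ∀ {m n} → + m ≺ + n → m < n
≺⇒ℕ< {m} {n} m≺n = ≼⇒ℕ≤ (nonNeg-by (+ n - (1ℤ + + m)) m≺n (shift (+ n) (+ m)))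
  where
  shift : ∀ x y → x - (1ℤ + y) ≡ x - y - 1ℤ
  shift x y = solve (x ∷ y ∷ [])

pos-∸ : ∀ {m n} → n ≤ m → + (m ℕ.∸ n) ≡ + m - + n
pos-∸ {m} {n} n≤m = sym (trans (ℤ.m-n≡m⊖n m n) (ℤ.⊖-≥ n≤m))

-- ⟨ a , b ⟩ is a + bω with ω² + Kω + 1 = 0; N is the norm, polar its polarisation and
-- swap z = −ω · conj z. The operations are inlined so that the ring solver sees polynomials.
module Quadratic (K : ℤ) where

  infixl 7 _·_
  infixl 6 _⊕_ _⊖_

  record ℤ[ω] : Set where
    constructor ⟨_,_⟩
    field re im : ℤ
  open ℤ[ω] public

  ι : ℤ → ℤ[ω]
  ι a = ⟨ a , 0ℤ ⟩
  {-# INLINE ι #-}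

  ω : ℤ[ω]
  ω = ⟨ 0ℤ , 1ℤ ⟩
  {-# INLINE ω #-}

  _⊕_ _⊖_ _·_ : ℤ[ω] → ℤ[ω] → ℤ[ω]
  x ⊕ y = ⟨ re x + re y , im x + im y ⟩
  x ⊖ y = ⟨ re x - re y , im x - im y ⟩
  x · y = ⟨ re x * re y - im x * im y , re x * im y + im x * re y - K * im x * im y ⟩
  {-# INLINE _⊕_ #-}
  {-# INLINE _⊖_ #-}
  {-# INLINE _·_ #-}

  conj swap : ℤ[ω] → ℤ[ω]
  conj x = ⟨ re x - K * im x , - im x ⟩
  swap x = ⟨ - im x , - re x ⟩
  {-# INLINE conj #-}
  {-# INLINE swap #-}

  N tr : ℤ[ω] → ℤ
  N x  = re x * re x - K * re x * im x + im x * im x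
  tr x = + 2 * re x - K * im x
  {-# INLINE N #-}
  {-# INLINE tr #-}

  polar det : ℤ[ω] → ℤ[ω] → ℤ
  polar x y = + 2 * re x * re y - K * (re x * im y + im x * re y) + + 2 * im x * im y
  det x y   = re x * im y - im x * re y
  {-# INLINE polar #-}
  {-# INLINE det #-}

  ℤ[ω]-≡ : ∀ x y → re x ≡ re y → im x ≡ im y → x ≡ y
  ℤ[ω]-≡ _ _ refl refl = refl

  N-· : ∀ x y → N (x · y) ≡ N x * N y
  N-· ⟨ a , b ⟩ ⟨ c , d ⟩ = solve (a ∷ b ∷ c ∷ d ∷ K ∷ [])

  N-conj : ∀ x → N (conj x) ≡ N x
  N-conj ⟨ a , b ⟩ = solve (a ∷ b ∷ K ∷ [])

  ·-comm : ∀ x y → x · y ≡ y · x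
  ·-comm x@(⟨ a , b ⟩) y@(⟨ c , d ⟩) =
    ℤ[ω]-≡ (x · y) (y · x) (solve (a ∷ b ∷ c ∷ d ∷ [])) (solve (a ∷ b ∷ c ∷ d ∷ K ∷ []))

  ·-conjʳ : ∀ x → x · conj x ≡ ι (N x)
  ·-conjʳ x@(⟨ a , b ⟩) =
    ℤ[ω]-≡ (x · conj x) (ι (N x)) (solve (a ∷ b ∷ K ∷ [])) (solve (a ∷ b ∷ K ∷ []))

  swap-· : ∀ x y → swap (x · y) ≡ conj x · swap y
  swap-· x@(⟨ a , b ⟩) y@(⟨ c , d ⟩) =
    ℤ[ω]-≡ (swap (x · y)) (conj x · swap y)
      (solve (a ∷ b ∷ c ∷ d ∷ K ∷ [])) (solve (a ∷ b ∷ c ∷ d ∷ K ∷ []))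

  swap-exchange : ∀ u v → swap ⟨ u , - v ⟩ ≡ ⟨ v , - u ⟩
  swap-exchange u v = ℤ[ω]-≡ (swap ⟨ u , - v ⟩) (⟨ v , - u ⟩) (ℤ.neg-involutive v) refl

  polar-conj : ∀ x y → polar (conj x) y ≡ tr (x · y)
  polar-conj ⟨ a , b ⟩ ⟨ c , d ⟩ = solve (a ∷ b ∷ c ∷ d ∷ K ∷ [])

  det-· : ∀ x y z → det (x · y) (x · z) ≡ N x * det y z
  det-· ⟨ a , b ⟩ ⟨ c , d ⟩ ⟨ e , f ⟩ = solve (a ∷ b ∷ c ∷ d ∷ e ∷ f ∷ K ∷ [])

  det-⊖⊖ : ∀ x y → det (x ⊖ y ⊖ y) y ≡ det x y
  det-⊖⊖ ⟨ a , b ⟩ ⟨ c , d ⟩ = solve (a ∷ b ∷ c ∷ d ∷ [])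

  ⊖⊖⊕⊕ : ∀ x y → x ⊖ y ⊖ y ⊕ y ⊕ y ≡ x
  ⊖⊖⊕⊕ x@(⟨ a , b ⟩) y@(⟨ c , d ⟩) =
    ℤ[ω]-≡ (x ⊖ y ⊖ y ⊕ y ⊕ y) x (solve (a ∷ c ∷ [])) (solve (b ∷ d ∷ []))

  -- For K = 2 the norm is (a − b)², so an isotropic β is a multiple of 1 + ω, and det β e = −1
  -- forces N e = 1.
  isotropic-K≡2 : K ≡ + 2 → ∀ β e → N β ≡ 0ℤ → det β e ≡ -1ℤ → N (β ⊕ e ⊕ e) ≡ + 4
  isotropic-K≡2 K≡2 β@(⟨ b₀ , b₁ ⟩) e@(⟨ y₀ , y₁ ⟩) Nβ≡0 δ =
    linear-combination (N (β ⊕ e ⊕ e)) (+ 4)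
      ((b₀ - b₁ + + 4 * (y₀ - y₁)) ⊛ b₀≡b₁ ⊞ + 4 ⊛ unit² ⊞ (- ((b₀ + y₀ + y₀) * (b₁ + y₁ + y₁))) ⊛ K≡2)
      (solve (b₀ ∷ b₁ ∷ y₀ ∷ y₁ ∷ K ∷ []))
    where
    b₀≡b₁ : b₀ - b₁ ≡ 0ℤ
    b₀≡b₁ = square≡0⇒≡0 (b₀ - b₁)
      (linear-combination ((b₀ - b₁) * (b₀ - b₁)) 0ℤ (Nβ≡0 ⊞ (b₀ * b₁) ⊛ K≡2) (solve (b₀ ∷ b₁ ∷ K ∷ [])))
    unit² : (y₁ - y₀) * (y₁ - y₀) ≡ 1ℤ
    unit² = unit-square b₀ (y₁ - y₀)
      (linear-combination (b₀ * (y₁ - y₀)) -1ℤ (δ ⊞ (- y₀) ⊛ b₀≡b₁) (solve (b₀ ∷ b₁ ∷ y₀ ∷ y₁ ∷ [])))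

-- p/q = [[b₁,…,bₗ]] and p′/q′ = [[b₁,…,bₗ₋₁]]: the product of the matrices (bᵢ −1; 1 0) is
-- (p −p′; q −q′).
record Convergents : Set where
  constructor conv
  field p q p′ q′ : ℤ
open Convergents public

cons snoc : ℤ → Convergents → Convergents
cons b C = conv (b * p C - q C) (p C) (b * p′ C - q′ C) (p′ C)
snoc x C = conv (x * p C - p′ C) (x * q C - q′ C) (p C) (q C)
{-# INLINE cons #-}
{-# INLINE snoc #-}

nil : Convergents
nil = conv 1ℤ 0ℤ 0ℤ -1ℤ
{-# INLINE nil #-}

convergents : List ℕ → Convergents
convergents []       = nil
convergents (b ∷ bs) = cons (+ b) (convergents bs)

conv-≡ : ∀ C D → p C ≡ p D → q C ≡ q D → p′ C ≡ p′ D → q′ C ≡ q′ D → C ≡ D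
conv-≡ _ _ refl refl refl refl = refl

cons-snoc : ∀ b x C → cons b (snoc x C) ≡ snoc x (cons b C)
cons-snoc b x C@(conv p q p′ q′) =
  conv-≡ (cons b (snoc x C)) (snoc x (cons b C)) (solve (b ∷ x ∷ p ∷ q ∷ p′ ∷ q′ ∷ [])) refl refl refl

cons-snoc-nil : ∀ x → cons x nil ≡ snoc x nil
cons-snoc-nil x = conv-≡ (cons x nil) (snoc x nil) refl (solve (x ∷ [])) (solve (x ∷ [])) refl

convergents-∷ʳ : ∀ bs x → convergents (bs ∷ʳ x) ≡ snoc (+ x) (convergents bs)
convergents-∷ʳ []       x = cons-snoc-nil (+ x)
convergents-∷ʳ (b ∷ bs) x =
  trans (cong (cons (+ b)) (convergents-∷ʳ bs x)) (cons-snoc (+ b) (+ x) (convergents bs))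

record Admissible (C : Convergents) : Set where
  field
    q′-nonNeg : 0ℤ ≼ q′ C
    q′<q      : q′ C ≺ q C
    q′<p′     : q′ C ≺ p′ C
    gap       : q C - q′ C ≼ p C - p′ C
    det≡1     : p′ C * q C - p C * q′ C ≡ 1ℤ

admissible-singleton : ∀ {b} → + 2 ≼ b → Admissible (cons b nil)
admissible-singleton {b} 2≤b = record
  { q′-nonNeg = 0 , refl
  ; q′<q      = 0 , refl
  ; q′<p′     = ≺-by 0ℤ (b * 0ℤ - -1ℤ) {0ℤ} (0 , refl) (solve (b ∷ []))
  ; gap       = ≼-by (1ℤ - 0ℤ) (b * 1ℤ - 0ℤ - (b * 0ℤ - -1ℤ)) 2≤b (solve (b ∷ []))
  ; det≡1     = solve (b ∷ [])
  }

admissible-cons : ∀ {b} C → + 2 ≼ b → Admissible C → Admissible (cons b C)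
admissible-cons {b} C@(conv p q p′ q′) 2≤b A = record
  { q′-nonNeg = ≼-by 0ℤ p′ (nonNeg-+ 0≤q′+1 q′<p′) (solve (p′ ∷ q′ ∷ []))
  ; q′<q      = ≺-by p′ p (nonNeg-+ gap q′<q) (solve (p ∷ q ∷ p′ ∷ q′ ∷ []))
  ; q′<p′     = ≺-by p′ (b * p′ - q′) (nonNeg-+ (nonNeg-* 2≤b (nonNeg-+ 0≤q′+1 q′<p′)) q′<p′)
                  (solve (b ∷ p′ ∷ q′ ∷ []))
  ; gap       = ≼-by (p - p′) (b * p - q - (b * p′ - q′))
                  (nonNeg-+ (nonNeg-* 2≤b (nonNeg-+ (nonNeg-+ gap q′<q) (1 , refl))) gap)
                  (solve (b ∷ p ∷ q ∷ p′ ∷ q′ ∷ []))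
  ; det≡1     = linear-combination ((b * p′ - q′) * p - (b * p - q) * p′) 1ℤ det≡1
                  (solve (b ∷ p ∷ q ∷ p′ ∷ q′ ∷ []))
  }
  where
  open Admissible A
  0≤q′+1 : NonNeg (q′ - 0ℤ + 1ℤ)
  0≤q′+1 = nonNeg-+ q′-nonNeg (1 , refl)

admissible : ∀ {b bs} → All (2 ≤_) (b ∷ bs) → Admissible (convergents (b ∷ bs))
admissible {b} {[]}     (2≤b All.∷ All.[]) = admissible-singleton {+ b} (ℕ≤⇒≼ 2≤b)
admissible {b} {c ∷ cs} (2≤b All.∷ 2≤bs)   =
  admissible-cons {+ b} (convergents (c ∷ cs)) (ℕ≤⇒≼ 2≤b) (admissible 2≤bs)

admissible-∷ʳ : ∀ mid x → All (2 ≤_) (mid ∷ʳ x) → Admissible (convergents (mid ∷ʳ x))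
admissible-∷ʳ []      x 2≤ = admissible 2≤
admissible-∷ʳ (_ ∷ _) x 2≤ = admissible 2≤

module _ {p q p′ q′ : ℤ} (A : Admissible (conv p q p′ q′)) where
  open Admissible A

  0<q : 0ℤ ≺ q
  0<q = ≺-by 0ℤ q (nonNeg-+ q′-nonNeg q′<q) (solve (q ∷ q′ ∷ []))

  0<p′ : 0ℤ ≺ p′
  0<p′ = ≺-by 0ℤ p′ (nonNeg-+ q′-nonNeg q′<p′) (solve (p′ ∷ q′ ∷ []))

  q<p : q ≺ p
  q<p = ≺-by q p (nonNeg-+ gap q′<p′) (solve (p ∷ q ∷ p′ ∷ q′ ∷ []))

  p′<p : p′ ≺ p
  p′<p = ≺-by p′ p (nonNeg-+ gap q′<q) (solve (p ∷ q ∷ p′ ∷ q′ ∷ []))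

  1<p : 1ℤ ≺ p
  1<p = ≺-by 1ℤ p (nonNeg-+ 0<q q<p) (solve (p ∷ q ∷ []))

  first-entry-two : let C = cons (+ 2) (conv p q p′ q′) in Convergents.p C - + 2 * Convergents.q C ≺ 0ℤ
  first-entry-two = ≺-by (+ 2 * p - q - + 2 * p) 0ℤ 0<q (solve (p ∷ q ∷ []))

  first-entry-large : ∀ {b} → + 3 ≼ b →
                      let C = cons b (conv p q p′ q′) in 0ℤ ≺ Convergents.p C - + 2 * Convergents.q C
  first-entry-large {b} 3≤b = ≺-by 0ℤ (b * p - q - + 2 * p)
    (nonNeg-+ (nonNeg-* 3≤b (nonNeg-+ (nonNeg-+ 0<q q<p) (2 , refl))) q<p) (solve (b ∷ p ∷ q ∷ []))

  last-entry-two : let C = snoc (+ 2) (conv p q p′ q′) in Convergents.p C - + 2 * Convergents.p′ C ≺ 0ℤ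
  last-entry-two = ≺-by (+ 2 * p - p′ - + 2 * p) 0ℤ 0<p′ (solve (p ∷ p′ ∷ []))

  last-entry-large : ∀ {x} → + 3 ≼ x →
                     let C = snoc x (conv p q p′ q′) in 0ℤ ≺ Convergents.p C - + 2 * Convergents.p′ C
  last-entry-large {x} 3≤x = ≺-by 0ℤ (x * p - p′ - + 2 * p)
    (nonNeg-+ (nonNeg-* 3≤x (nonNeg-+ (nonNeg-+ 0<q q<p) (2 , refl))) p′<p) (solve (x ∷ p ∷ q ∷ p′ ∷ []))

hjEval-convergents : ∀ {b bs} → All (2 ≤_) (b ∷ bs) →
                     + proj₁ (hjEval (b ∷ bs)) ≡ p (convergents (b ∷ bs)) ×
                     + proj₂ (hjEval (b ∷ bs)) ≡ q (convergents (b ∷ bs))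
hjEval-convergents {b} {[]} _ = x≡x*1-0 (+ b) , refl
  where
  x≡x*1-0 : ∀ x → x ≡ x * 1ℤ - 0ℤ
  x≡x*1-0 = solve-∀
hjEval-convergents {suc b} {c ∷ cs} (_ All.∷ 2≤cs) = numerator , proj₁ IH
  where
  open ≡-Reasoning
  n = proj₁ (hjEval (c ∷ cs))
  d = proj₂ (hjEval (c ∷ cs))
  IH = hjEval-convergents 2≤cs
  d≤bn : d ≤ suc b ℕ.* n
  d≤bn = ℕ.≤-trans (ℕ.<⇒≤ (≺⇒ℕ< (subst₂ _≺_ (sym (proj₂ IH)) (sym (proj₁ IH)) (q<p (admissible 2≤cs)))))
                   (ℕ.m≤n*m n (suc b))
  numerator : + (suc b ℕ.* n ℕ.∸ d) ≡ + suc b * p (convergents (c ∷ cs)) - q (convergents (c ∷ cs))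
  numerator = begin
    + (suc b ℕ.* n ℕ.∸ d)  ≡⟨ pos-∸ d≤bn ⟩
    + (suc b ℕ.* n) - + d  ≡⟨ cong (_- + d) (ℤ.pos-* (suc b) n) ⟩
    + suc b * + n - + d    ≡⟨ cong₂ (λ x y → + suc b * x - y) (proj₁ IH) (proj₂ IH) ⟩
    + suc b * p (convergents (c ∷ cs)) - q (convergents (c ∷ cs)) ∎

module Certificates (K : ℤ) where
  open Quadratic K

  record WahlCertificate (C : Convergents) : Set where
    field
      relation : p′ C + q C + K ≡ p C
      e₁ e₂    : ℤ[ω]
      N-e₁     : N e₁ ≡ p C
      N-e₂     : N e₂ ≡ q C - q′ C
      polar-e  : polar e₁ e₂ ≡ + 2 * q C + K
      det-e    : det e₁ e₂ ≡ -1ℤ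

  certificate-peelˡ : ∀ b X → WahlCertificate (cons (1ℤ + b) (snoc (+ 2) X)) → WahlCertificate (cons b X)
  certificate-peelˡ b (conv m e m′ e′) record
    { relation = r ; e₁ = x@(⟨ x₀ , x₁ ⟩) ; e₂ = y@(⟨ y₀ , y₁ ⟩)
    ; N-e₁ = n₁ ; N-e₂ = n₂ ; polar-e = π ; det-e = δ } = record
    { relation = linear-combination (b * m′ - e′ + m + K) (b * m - e) r (solve (b ∷ m ∷ e ∷ m′ ∷ e′ ∷ K ∷ []))
    ; e₁ = x ⊖ y
    ; e₂ = y
    ; N-e₁ = linear-combination (N (x ⊖ y)) (b * m - e) (n₁ ⊞ -1ℤ ⊛ π ⊞ n₂ ⊞ -1ℤ ⊛ r)
               (solve (b ∷ m ∷ e ∷ m′ ∷ e′ ∷ x₀ ∷ x₁ ∷ y₀ ∷ y₁ ∷ K ∷ []))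
    ; N-e₂ = linear-combination (N y) (m - m′) n₂ (solve (m ∷ e ∷ m′ ∷ e′ ∷ y₀ ∷ y₁ ∷ K ∷ []))
    ; polar-e = linear-combination (polar (x ⊖ y) y) (+ 2 * m + K) (π ⊞ - + 2 ⊛ n₂)
                  (solve (b ∷ m ∷ e ∷ m′ ∷ e′ ∷ x₀ ∷ x₁ ∷ y₀ ∷ y₁ ∷ K ∷ []))
    ; det-e = linear-combination (det (x ⊖ y) y) -1ℤ δ (solve (x₀ ∷ x₁ ∷ y₀ ∷ y₁ ∷ []))
    }

  certificate-peelʳ : ∀ x X → WahlCertificate (cons (+ 2) (snoc (1ℤ + x) X)) → WahlCertificate (snoc x X)
  certificate-peelʳ x (conv m e m′ e′) record
    { relation = r ; e₁ = u@(⟨ x₀ , x₁ ⟩) ; e₂ = v@(⟨ y₀ , y₁ ⟩)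
    ; N-e₁ = n₁ ; N-e₂ = n₂ ; polar-e = π ; det-e = δ } = record
    { relation = linear-combination (m + (x * e - e′) + K) (x * m - m′) r (solve (x ∷ m ∷ e ∷ m′ ∷ e′ ∷ K ∷ []))
    ; e₁ = v
    ; e₂ = v ⊕ v ⊖ u
    ; N-e₁ = linear-combination (N v) (x * m - m′) n₂ (solve (x ∷ m ∷ e ∷ m′ ∷ e′ ∷ y₀ ∷ y₁ ∷ K ∷ []))
    ; N-e₂ = linear-combination (N (v ⊕ v ⊖ u)) (x * e - e′ - e) (+ 4 ⊛ n₂ ⊞ - + 2 ⊛ π ⊞ n₁ ⊞ - + 2 ⊛ r)
               (solve (x ∷ m ∷ e ∷ m′ ∷ e′ ∷ x₀ ∷ x₁ ∷ y₀ ∷ y₁ ∷ K ∷ []))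
    ; polar-e = linear-combination (polar v (v ⊕ v ⊖ u)) (+ 2 * (x * e - e′) + K)
                  (+ 4 ⊛ n₂ ⊞ -1ℤ ⊛ π ⊞ - + 2 ⊛ r) (solve (x ∷ m ∷ e ∷ m′ ∷ e′ ∷ x₀ ∷ x₁ ∷ y₀ ∷ y₁ ∷ K ∷ []))
    ; det-e = linear-combination (det v (v ⊕ v ⊖ u)) -1ℤ δ (solve (x₀ ∷ x₁ ∷ y₀ ∷ y₁ ∷ []))
    }

  certificate-singleton : ∀ b → WahlCertificate (cons b nil) → b ≡ K + + 2
  certificate-singleton b cert =
    linear-combination b (K + + 2) (-1ℤ ⊛ WahlCertificate.relation cert) (solve (b ∷ K ∷ []))

  ends-sum : ∀ {p q p′ q′} → WahlCertificate (conv p q p′ q′) → (p - + 2 * q) + (p - + 2 * p′) ≡ + 2 * K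
  ends-sum {p} {q} {p′} cert =
    linear-combination ((p - + 2 * q) + (p - + 2 * p′)) (+ 2 * K) (- + 2 ⊛ WahlCertificate.relation cert)
      (solve (p ∷ q ∷ p′ ∷ K ∷ []))

  ends-product : ∀ {p q p′ q′} (cert : WahlCertificate (conv p q p′ q′)) → p′ * q - p * q′ ≡ 1ℤ →
                 let open WahlCertificate cert in
                 p * N (e₁ ⊖ e₂ ⊖ e₂) ≡ + 4 - (p - + 2 * q) * (p - + 2 * p′)
  ends-product {p} {q} {p′} {q′} record
    { relation = r ; e₁ = x@(⟨ x₀ , x₁ ⟩) ; e₂ = y@(⟨ y₀ , y₁ ⟩) ; N-e₁ = n₁ ; N-e₂ = n₂ ; polar-e = π } det≡1 =
    linear-combination (p * N (x ⊖ y ⊖ y)) (+ 4 - (p - + 2 * q) * (p - + 2 * p′))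
      (p ⊛ n₁ ⊞ (- + 2 * p) ⊛ π ⊞ (+ 4 * p) ⊛ n₂ ⊞ + 4 ⊛ det≡1 ⊞ (- + 2 * p) ⊛ r)
      (solve (p ∷ q ∷ p′ ∷ q′ ∷ x₀ ∷ x₁ ∷ y₀ ∷ y₁ ∷ K ∷ []))

-- Vieta jumping: if 2y > Kx then (x, Kx − y) is a smaller solution; otherwise Kx = 2y + s and
-- y = x + t give (n + 2 − K) x = 2t (x² − 1) + t² x + s (x² − 1) + s t x ≥ 0.
module Vieta (K : ℤ) where

  vieta-bound-ordered : ∀ fuel {x y n} → x + y ≺ + fuel → 0ℤ ≺ x → x ≼ y → NonNeg n →
                        K * x * y ≡ x * x + y * y + n → K ≼ n + + 2
  vieta-bound-ordered zero {x} {y} x+y<0 0<x x≤y _ _ = ⊥-elim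
    (nonNeg+1≢0 (nonNeg-+ (nonNeg-+ (nonNeg-+ x+y<0 0<x) (nonNeg-+ 0<x x≤y)) (2 , refl)) (solve (x ∷ y ∷ [])))
  vieta-bound-ordered (suc fuel) {x} {y} {n} x+y<f 0<x x≤y 0≤n eq = bound-or-jump (≼-total (+ 2 * y) (K * x))
    where
    0≤x : NonNeg (x - 0ℤ)
    0≤x = nonNeg-by (x - 0ℤ) (nonNeg-+ 0<x (1 , refl)) (solve (x ∷ []))

    x²-1 : NonNeg ((x - 0ℤ - 1ℤ) * (x - 0ℤ - 1ℤ) + + 2 * (x - 0ℤ - 1ℤ))
    x²-1 = nonNeg-+ (nonNeg-* 0<x 0<x) (nonNeg-* (2 , refl) 0<x)

    bound : + 2 * y ≼ K * x → K ≼ n + + 2 ⊎ n + + 2 ≺ K → K ≼ n + + 2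
    bound _     (inj₁ K≤n+2) = K≤n+2
    bound 2y≤Kx (inj₂ n+2<K) = ⊥-elim (nonNeg-contradiction
      (nonNeg-+ (nonNeg-+ excess (nonNeg-* n+2<K 0≤x)) 0<x) (x ⊛ eq) (solve (x ∷ y ∷ n ∷ K ∷ [])))
      where
      excess : NonNeg (+ 2 * (y - x) * ((x - 0ℤ - 1ℤ) * (x - 0ℤ - 1ℤ) + + 2 * (x - 0ℤ - 1ℤ))
                       + (y - x) * (y - x) * (x - 0ℤ)
                       + (K * x - + 2 * y) * ((x - 0ℤ - 1ℤ) * (x - 0ℤ - 1ℤ) + + 2 * (x - 0ℤ - 1ℤ))
                       + (K * x - + 2 * y) * (y - x) * (x - 0ℤ))
      excess = nonNeg-+ (nonNeg-+ (nonNeg-+ (nonNeg-* (nonNeg-* (2 , refl) x≤y) x²-1)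
                                            (nonNeg-* (nonNeg-* x≤y x≤y) 0≤x))
                                  (nonNeg-* 2y≤Kx x²-1))
                        (nonNeg-* (nonNeg-* 2y≤Kx x≤y) 0≤x)

    jump : K * x ≺ + 2 * y → K ≼ n + + 2
    jump Kx<2y = descend (≼-total x (K * x - y))
      where
      0<y′ : 0ℤ ≺ K * x - y
      0<y′ = positive (≼-total 1ℤ (K * x - y))
        where
        positive : 1ℤ ≼ K * x - y ⊎ K * x - y ≺ 1ℤ → 0ℤ ≺ K * x - y
        positive (inj₁ 1≤y′) = ≺-by 0ℤ (K * x - y) 1≤y′ (solve (x ∷ y ∷ K ∷ []))
        positive (inj₂ y′<1) = ⊥-elim (nonNeg-contradiction
          (nonNeg-+ (nonNeg-+ (nonNeg-* (nonNeg-+ (nonNeg-+ 0<x x≤y) (1 , refl)) y′<1) x²-1) 0≤n)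
          (-1ℤ ⊛ eq) (solve (x ∷ y ∷ n ∷ K ∷ [])))

      y′<y : K * x - y ≺ y
      y′<y = ≺-by (K * x - y) y Kx<2y (solve (x ∷ y ∷ K ∷ []))

      eq′ : K * x * (K * x - y) ≡ x * x + (K * x - y) * (K * x - y) + n
      eq′ = linear-combination (K * x * (K * x - y)) (x * x + (K * x - y) * (K * x - y) + n) eq
              (solve (x ∷ y ∷ n ∷ K ∷ []))

      fuel-step : ∀ F → F - (x + (K * x - y)) - 1ℤ ≡ (1ℤ + F) - (x + y) - 1ℤ + (y - (K * x - y) - 1ℤ)
      fuel-step F = solve (F ∷ x ∷ y ∷ K ∷ [])

      x+y′<f : x + (K * x - y) ≺ + fuel
      x+y′<f = nonNeg-by (+ fuel - (x + (K * x - y)) - 1ℤ) (nonNeg-+ x+y<f y′<y) (fuel-step (+ fuel))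

      descend : x ≼ K * x - y ⊎ K * x - y ≺ x → K ≼ n + + 2
      descend (inj₁ x≤y′) = vieta-bound-ordered fuel {x} {K * x - y} {n} x+y′<f 0<x x≤y′ 0≤n eq′
      descend (inj₂ y′<x) = vieta-bound-ordered fuel {K * x - y} {x} {n}
        (≺-+-comm {x} {K * x - y} {+ fuel} x+y′<f) 0<y′ (≺⇒≼ {K * x - y} {x} y′<x) 0≤n
        (linear-combination (K * (K * x - y) * x) ((K * x - y) * (K * x - y) + x * x + n) eq′
          (solve (x ∷ y ∷ n ∷ K ∷ [])))

    bound-or-jump : + 2 * y ≼ K * x ⊎ K * x ≺ + 2 * y → K ≼ n + + 2
    bound-or-jump (inj₁ 2y≤Kx) = bound 2y≤Kx (≼-total K (n + + 2))
    bound-or-jump (inj₂ Kx<2y) = jump Kx<2y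

  vieta-bound : ∀ {x y n} → 0ℤ ≺ x → 0ℤ ≺ y → NonNeg n → K * x * y ≡ x * x + y * y + n → K ≼ n + + 2
  vieta-bound {x} {y} {n} 0<x 0<y 0≤n eq = start (≼-total x y)
    where
    x+y-nonNeg : NonNeg (x + y)
    x+y-nonNeg = nonNeg-by (x + y) (nonNeg-+ (nonNeg-+ 0<x 0<y) (2 , refl)) (solve (x ∷ y ∷ []))

    fuel = proj₁ x+y-nonNeg

    fuel-start : ∀ M → x + y ≡ M → (1ℤ + M) - (x + y) - 1ℤ ≡ 0ℤ
    fuel-start M h = linear-combination ((1ℤ + M) - (x + y) - 1ℤ) 0ℤ (-1ℤ ⊛ h) (solve (x ∷ y ∷ M ∷ []))

    x+y<f : x + y ≺ + suc fuel
    x+y<f = 0 , fuel-start (+ fuel) (proj₂ x+y-nonNeg)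

    start : x ≼ y ⊎ y ≺ x → K ≼ n + + 2
    start (inj₁ x≤y) = vieta-bound-ordered (suc fuel) {x} {y} {n} x+y<f 0<x x≤y 0≤n eq
    start (inj₂ y<x) = vieta-bound-ordered (suc fuel) {y} {x} {n}
      (≺-+-comm {x} {y} {+ suc fuel} x+y<f) 0<y (≺⇒≼ {y} {x} y<x) 0≤n
      (linear-combination (K * y * x) (y * y + x * x + n) eq (solve (x ∷ y ∷ n ∷ K ∷ [])))

module Ends (K : ℤ) (0≤K : NonNeg K) where
  open Quadratic K
  open Certificates K
  open Vieta K

  vieta-bound-unimodular : ∀ {x y r s n} → x * s - y * r ≡ -1ℤ → NonNeg n →
                           x * x - K * x * y + y * y ≡ - n → K ≼ n + + 2
  vieta-bound-unimodular {x} {y} {r} {s} {n} unimodular 0≤n eq = cases (trichotomy x) (trichotomy y)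
    where
    degenerate : NonNeg (0ℤ - x * y) → ⊥
    degenerate 0≤-xy =
      nonNeg-contradiction (0 , refl) (unimodular ⊞ (- s) ⊛ x≡0 ⊞ r ⊛ y≡0) (solve (x ∷ y ∷ r ∷ s ∷ []))
      where
      cross : NonNeg (K * (0ℤ - x * y) + n)
      cross = nonNeg-+ (nonNeg-* 0≤K 0≤-xy) 0≤n
      x≡0 : x ≡ 0ℤ
      x≡0 = square≡0⇒≡0 x (nonNeg-sum-zero (square-nonNeg x) (nonNeg-+ (square-nonNeg y) cross) eq
              (solve (x ∷ y ∷ n ∷ K ∷ [])))
      y≡0 : y ≡ 0ℤ
      y≡0 = square≡0⇒≡0 y (nonNeg-sum-zero (square-nonNeg y) (nonNeg-+ (square-nonNeg x) cross) eq
              (solve (x ∷ y ∷ n ∷ K ∷ [])))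

    cases : 0ℤ ≺ x ⊎ x ≡ 0ℤ ⊎ x ≺ 0ℤ → 0ℤ ≺ y ⊎ y ≡ 0ℤ ⊎ y ≺ 0ℤ → K ≼ n + + 2
    cases (inj₁ 0<x) (inj₁ 0<y) = vieta-bound {x} {y} {n} 0<x 0<y 0≤n
      (linear-combination (K * x * y) (x * x + y * y + n) (-1ℤ ⊛ eq) (solve (x ∷ y ∷ n ∷ K ∷ [])))
    cases (inj₂ (inj₂ x<0)) (inj₂ (inj₂ y<0)) = vieta-bound { - x} { - y} {n}
      (≺-by 0ℤ (- x) x<0 (solve (x ∷ []))) (≺-by 0ℤ (- y) y<0 (solve (y ∷ []))) 0≤n
      (linear-combination (K * - x * - y) (- x * - x + - y * - y + n) (-1ℤ ⊛ eq) (solve (x ∷ y ∷ n ∷ K ∷ [])))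
    cases (inj₁ 0<x) (inj₂ (inj₂ y<0)) = ⊥-elim (degenerate
      (nonNeg-by (0ℤ - x * y) (nonNeg-* (nonNeg-+ 0<x (1 , refl)) (nonNeg-+ y<0 (1 , refl))) (solve (x ∷ y ∷ []))))
    cases (inj₂ (inj₂ x<0)) (inj₁ 0<y) = ⊥-elim (degenerate
      (nonNeg-by (0ℤ - x * y) (nonNeg-* (nonNeg-+ x<0 (1 , refl)) (nonNeg-+ 0<y (1 , refl))) (solve (x ∷ y ∷ []))))
    cases (inj₂ (inj₁ x≡0)) _ = ⊥-elim (degenerate
      (0 , linear-combination (0ℤ - x * y) (+ 0) ((- y) ⊛ x≡0) (solve (x ∷ y ∷ []))))
    cases _ (inj₂ (inj₁ y≡0)) = ⊥-elim (degenerate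
      (0 , linear-combination (0ℤ - x * y) (+ 0) ((- x) ⊛ y≡0) (solve (x ∷ y ∷ []))))

  ends-not-both-two : ∀ {A B} → A ≺ 0ℤ → B ≺ 0ℤ → A + B ≡ + 2 * K → ⊥
  ends-not-both-two {A} {B} A<0 B<0 sum = nonNeg-contradiction
    (nonNeg-+ (nonNeg-+ (nonNeg-+ A<0 B<0) (nonNeg-* (2 , refl) 0≤K)) (1 , refl)) (-1ℤ ⊛ sum)
    (solve (A ∷ B ∷ K ∷ []))

  positive-defect-impossible : ∀ {p A B n} → p * n ≡ + 4 - A * B → 0ℤ ≺ A → 0ℤ ≺ B → + 5 ≼ p → 1ℤ ≼ n → ⊥
  positive-defect-impossible {p} {A} {B} {n} product 0<A 0<B 5≤p 1≤n = nonNeg-contradiction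
    (nonNeg-+ (nonNeg-+ (nonNeg-+ (nonNeg-+ (nonNeg-+ (nonNeg-+ (nonNeg-* 0<A 0<B) 0<A) 0<B)
      (nonNeg-* 5≤p 1≤n)) 5≤p) (nonNeg-* (5 , refl) 1≤n)) (1 , refl))
    product (solve (p ∷ A ∷ B ∷ n ∷ []))

  -- With m = −n and t = m + 2 − K both nonnegative, the two equations give
  -- 4m + 4(p − K − 3)m + (A − B)² + 4Kt + 8t = 0.
  nonpositive-defect : ∀ {p A B n} → p * n ≡ + 4 - A * B → A + B ≡ + 2 * K → K + + 3 ≼ p →
                       n ≺ 1ℤ → K ≼ (1ℤ - n - 1ℤ) + + 2 → n ≡ 0ℤ × K ≡ + 2
  nonpositive-defect {p} {A} {B} {n} product sum K+3≤p n≤0 K≤2-n = n≡0 , K≡2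
    where
    total : (1ℤ - n - 1ℤ) * + 4 + (p - (K + + 3)) * (1ℤ - n - 1ℤ) * + 4 + (A - B) * (A - B)
            + K * ((1ℤ - n - 1ℤ) + + 2 - K) * + 4 + ((1ℤ - n - 1ℤ) + + 2 - K) * + 8 ≡ 0ℤ
    total = linear-combination
      ((1ℤ - n - 1ℤ) * + 4 + (p - (K + + 3)) * (1ℤ - n - 1ℤ) * + 4 + (A - B) * (A - B)
        + K * ((1ℤ - n - 1ℤ) + + 2 - K) * + 4 + ((1ℤ - n - 1ℤ) + + 2 - K) * + 8) 0ℤ
      (- + 4 ⊛ product ⊞ (A + B + + 2 * K) ⊛ sum) (solve (p ∷ A ∷ B ∷ n ∷ K ∷ []))
    common : NonNeg ((p - (K + + 3)) * (1ℤ - n - 1ℤ) * + 4 + (A - B) * (A - B)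
                     + K * ((1ℤ - n - 1ℤ) + + 2 - K) * + 4)
    common = nonNeg-+ (nonNeg-+ (nonNeg-* (nonNeg-* K+3≤p n≤0) (4 , refl)) (square-nonNeg (A - B)))
                      (nonNeg-* (nonNeg-* 0≤K K≤2-n) (4 , refl))
    m≡0 : 1ℤ - n - 1ℤ ≡ 0ℤ
    m≡0 = nonNeg-sum-zero n≤0 (nonNeg-+ (nonNeg-+ (nonNeg-* n≤0 (3 , refl)) common) (nonNeg-* K≤2-n (8 , refl)))
            total (solve (p ∷ A ∷ B ∷ n ∷ K ∷ []))
    n≡0 : n ≡ 0ℤ
    n≡0 = linear-combination n 0ℤ (-1ℤ ⊛ m≡0) (solve (n ∷ []))
    t≡0 : (1ℤ - n - 1ℤ) + + 2 - K ≡ 0ℤ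
    t≡0 = nonNeg-sum-zero K≤2-n (nonNeg-+ (nonNeg-+ (nonNeg-* n≤0 (4 , refl)) common) (nonNeg-* K≤2-n (7 , refl)))
            total (solve (p ∷ A ∷ B ∷ n ∷ K ∷ []))
    K≡2 : K ≡ + 2
    K≡2 = linear-combination K (+ 2) (-1ℤ ⊛ t≡0 ⊞ -1ℤ ⊛ n≡0) (solve (n ∷ K ∷ []))

  ends-not-both-large : ∀ {p q p′ q′} → WahlCertificate (conv p q p′ q′) → p′ * q - p * q′ ≡ 1ℤ →
                        0ℤ ≺ p - + 2 * q → 0ℤ ≺ p - + 2 * p′ → 1ℤ ≺ q → 0ℤ ≺ p′ → ⊥
  ends-not-both-large {p} {q} {p′} {q′} cert unimodular 0<A 0<B 1<q 0<p′ = by-sign (≼-total 1ℤ (N β))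
    where
    open WahlCertificate cert
    open ≡-Reasoning
    β = e₁ ⊖ e₂ ⊖ e₂
    A = p - + 2 * q
    B = p - + 2 * p′

    5≤p : + 5 ≼ p
    5≤p = ≼-by (+ 5) p (nonNeg-+ 0<A (nonNeg-* (2 , refl) 1<q)) (solve (p ∷ q ∷ []))

    K+3≤p : K + + 3 ≼ p
    K+3≤p = nonNeg-via (p - (K + + 3)) (nonNeg-+ 0<p′ 1<q) (-1ℤ ⊛ relation) (solve (p ∷ q ∷ p′ ∷ K ∷ []))

    negated : ∀ n → n ≡ - (1ℤ - n - 1ℤ)
    negated n = solve (n ∷ [])

    isotropic : N β ≡ 0ℤ × K ≡ + 2 → ⊥
    isotropic (Nβ≡0 , K≡2) = nonNeg-contradiction 5≤p p≡4 (solve (p ∷ []))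
      where
      p≡4 : p ≡ + 4
      p≡4 = begin
        p               ≡⟨ sym N-e₁ ⟩
        N e₁            ≡⟨ cong N (sym (⊖⊖⊕⊕ e₁ e₂)) ⟩
        N (β ⊕ e₂ ⊕ e₂) ≡⟨ isotropic-K≡2 K≡2 β e₂ Nβ≡0 (trans (det-⊖⊖ e₁ e₂) det-e) ⟩
        + 4             ∎

    by-sign : 1ℤ ≼ N β ⊎ N β ≺ 1ℤ → ⊥
    by-sign (inj₁ 1≤n) =
      positive-defect-impossible {p} {A} {B} {N β} (ends-product cert unimodular) 0<A 0<B 5≤p 1≤n
    by-sign (inj₂ n≤0) = isotropic (nonpositive-defect {p} {A} {B} {N β}
      (ends-product cert unimodular) (ends-sum cert) K+3≤p n≤0
      (vieta-bound-unimodular {re β} {im β} {re e₂} {im e₂} {1ℤ - N β - 1ℤ}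
        (trans (det-⊖⊖ e₁ e₂) det-e) n≤0 (negated (N β))))

length-∷ʳ : ∀ (xs : List ℕ) x → length (xs ∷ʳ x) ≡ suc (length xs)
length-∷ʳ xs x = trans (length-++ xs) (ℕ.+-comm (length xs) 1)

module WahlChains (k : ℕ) where
  open Certificates (+ k)
  open Ends (+ k) (+-nonNeg k)

  Certified : List ℕ → Set
  Certified bs = WahlCertificate (convergents bs)

  WahlBelow : List ℕ → Set
  WahlBelow bs = ∀ cs → length cs < length bs → 1 ≤ length cs → All (2 ≤_) cs → Certified cs → KWahl k cs

  certificate⇒KWahl-by-ends : ∀ b mid x → 2 ≤ b → 2 ≤ x → All (2 ≤_) mid → WahlBelow (b ∷ mid ∷ʳ x) →
                              Certified (b ∷ mid ∷ʳ x) → KWahl k (b ∷ mid ∷ʳ x)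
  certificate⇒KWahl-by-ends 2 mid 2 2≤b 2≤x 2≤mid _ cert =
    ⊥-elim (ends-not-both-two {A} {B} A<0 B<0 (ends-sum cert))
    where
    C = convergents (2 ∷ mid ∷ʳ 2)
    A = Convergents.p C - + 2 * Convergents.q C
    B = Convergents.p C - + 2 * Convergents.p′ C
    A<0 : A ≺ 0ℤ
    A<0 = first-entry-two (admissible-∷ʳ mid 2 (∷ʳ⁺ 2≤mid 2≤x))
    B<0 : B ≺ 0ℤ
    B<0 = subst (λ C → Convergents.p C - + 2 * Convergents.p′ C ≺ 0ℤ) (sym (convergents-∷ʳ (2 ∷ mid) 2))
                (last-entry-two (admissible (2≤b All.∷ 2≤mid)))
  certificate⇒KWahl-by-ends (suc (suc (suc b))) mid 2 _ _ 2≤mid IH cert =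
    stepL (IH (suc (suc b) ∷ mid) (s≤s (ℕ.≤-reflexive (sym (length-∷ʳ mid 2)))) (s≤s z≤n)
              (s≤s (s≤s z≤n) All.∷ 2≤mid)
              (certificate-peelˡ (+ suc (suc b)) (convergents mid)
                (subst (λ C → WahlCertificate (cons (+ suc (suc (suc b))) C)) (convergents-∷ʳ mid 2) cert)))
  certificate⇒KWahl-by-ends 2 mid (suc (suc (suc x))) _ _ 2≤mid IH cert =
    stepR (IH (mid ∷ʳ suc (suc x))
              (subst₂ _<_ (sym (length-∷ʳ mid _)) (cong suc (sym (length-∷ʳ mid _))) (ℕ.n<1+n _))
              (subst (1 ≤_) (sym (length-∷ʳ mid _)) (s≤s z≤n))
              (∷ʳ⁺ 2≤mid (s≤s (s≤s z≤n)))
              (subst WahlCertificate (sym (convergents-∷ʳ mid (suc (suc x))))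
                (certificate-peelʳ (+ suc (suc x)) (convergents mid)
                  (subst (λ C → WahlCertificate (cons (+ 2) C)) (convergents-∷ʳ mid (suc (suc (suc x)))) cert))))
  certificate⇒KWahl-by-ends (suc (suc (suc b))) mid (suc (suc (suc x))) 2≤b 2≤x 2≤mid _ cert =
    ⊥-elim (ends-not-both-large cert (Admissible.det≡1 whole) 0<A 0<B (1<p rest) (0<p′ whole))
    where
    rest = admissible-∷ʳ mid _ (∷ʳ⁺ 2≤mid 2≤x)
    whole = admissible (2≤b All.∷ ∷ʳ⁺ 2≤mid 2≤x)
    0<A = first-entry-large rest {+ suc (suc (suc b))} (ℕ≤⇒≼ (s≤s (s≤s (s≤s z≤n))))
    0<B = subst (λ C → 0ℤ ≺ Convergents.p C - + 2 * Convergents.p′ C)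
                (sym (convergents-∷ʳ (suc (suc (suc b)) ∷ mid) _))
                (last-entry-large (admissible (2≤b All.∷ 2≤mid)) {+ suc (suc (suc x))} (ℕ≤⇒≼ (s≤s (s≤s (s≤s z≤n)))))
  certificate⇒KWahl-by-ends zero          _ _          ()       _        _ _ _
  certificate⇒KWahl-by-ends (suc zero)    _ _          (s≤s ()) _        _ _ _
  certificate⇒KWahl-by-ends (suc (suc _)) _ zero       _        ()       _ _ _
  certificate⇒KWahl-by-ends (suc (suc _)) _ (suc zero) _        (s≤s ()) _ _ _

  certificate⇒KWahl : ∀ bs → Acc _<_ (length bs) → 1 ≤ length bs → All (2 ≤_) bs → Certified bs → KWahl k bs
  certificate⇒KWahl []       _         ()
  certificate⇒KWahl (b ∷ bs) (acc rec) _ 2≤ cert with initLast bs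
  ... | []        = subst (λ b → KWahl k (b ∷ [])) (sym (ℤ.+-injective (certificate-singleton (+ b) cert))) base
  ... | mid ∷ʳ′ x = certificate⇒KWahl-by-ends b mid x (All.head 2≤) (proj₂ (∷ʳ⁻ (All.tail 2≤)))
                      (proj₁ (∷ʳ⁻ (All.tail 2≤))) (λ cs lt → certificate⇒KWahl cs (rec lt)) cert

module MarkovTriples (K : ℤ) where
  open Quadratic K

  T : ℤ
  T = + 3 * (K + 1ℤ)
  {-# INLINE T #-}

  record MarkovData (a b c : ℤ) : Set where
    field
      equation          : a * a + b * b + c * c + K * (a * b + b * c + c * a) ≡ T * a * b * c
      α₁ α₂ α₃ β₁ β₂ β₃ : ℤ[ω]
      N-α₁              : N α₁ ≡ a
      N-α₂              : N α₂ ≡ b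
      N-α₃              : N α₃ ≡ c
      factor₁           : conj α₁ · β₁ ≡ ⟨ c , - b ⟩
      factor₂           : conj α₂ · β₂ ≡ ⟨ a , - c ⟩
      factor₃           : conj α₃ · β₃ ≡ ⟨ b , - a ⟩
      bézout₁₂          : ∃[ l ] ∃[ m ] l * a + m * b ≡ 1ℤ
      bézout₂₃          : ∃[ l ] ∃[ m ] l * b + m * c ≡ 1ℤ

  markovData-root : MarkovData 1ℤ (K + + 2) 1ℤ
  markovData-root = record
    { equation = solve (K ∷ [])
    ; α₁ = ι 1ℤ ; α₂ = ⟨ 1ℤ , -1ℤ ⟩ ; α₃ = ι 1ℤ
    ; β₁ = ⟨ 1ℤ , - (K + + 2) ⟩ ; β₂ = ⟨ 0ℤ , -1ℤ ⟩ ; β₃ = ⟨ K + + 2 , -1ℤ ⟩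
    ; N-α₁ = solve (K ∷ [])
    ; N-α₂ = solve (K ∷ [])
    ; N-α₃ = solve (K ∷ [])
    ; factor₁ = ℤ[ω]-≡ (conj (ι 1ℤ) · ⟨ 1ℤ , - (K + + 2) ⟩) ⟨ 1ℤ , - (K + + 2) ⟩ (solve (K ∷ [])) (solve (K ∷ []))
    ; factor₂ = ℤ[ω]-≡ (conj ⟨ 1ℤ , -1ℤ ⟩ · ⟨ 0ℤ , -1ℤ ⟩) ⟨ 1ℤ , -1ℤ ⟩ (solve (K ∷ [])) (solve (K ∷ []))
    ; factor₃ = ℤ[ω]-≡ (conj (ι 1ℤ) · ⟨ K + + 2 , -1ℤ ⟩) ⟨ K + + 2 , -1ℤ ⟩ (solve (K ∷ [])) (solve (K ∷ []))
    ; bézout₁₂ = 1ℤ , 0ℤ , solve (K ∷ [])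
    ; bézout₂₃ = 0ℤ , 1ℤ , solve (K ∷ [])
    }

  swap-factor : ∀ x y {u v} → conj x · y ≡ ⟨ u , - v ⟩ → conj (conj x) · swap y ≡ ⟨ v , - u ⟩
  swap-factor x y {u} {v} eq = begin
    conj (conj x) · swap y ≡⟨ sym (swap-· (conj x) y) ⟩
    swap (conj x · y)      ≡⟨ cong swap eq ⟩
    swap ⟨ u , - v ⟩       ≡⟨ swap-exchange u v ⟩
    (⟨ v , - u ⟩)          ∎
    where open ≡-Reasoning

  markovData-reverse : ∀ {a b c} → MarkovData a b c → MarkovData c b a
  markovData-reverse {a} {b} {c} D = record
    { equation = linear-combination (c * c + b * b + a * a + K * (c * b + b * a + a * c)) (T * c * b * a)
                   equation (solve (a ∷ b ∷ c ∷ K ∷ []))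
    ; α₁ = conj α₃ ; α₂ = conj α₂ ; α₃ = conj α₁
    ; β₁ = swap β₃ ; β₂ = swap β₂ ; β₃ = swap β₁
    ; N-α₁ = trans (N-conj α₃) N-α₃
    ; N-α₂ = trans (N-conj α₂) N-α₂
    ; N-α₃ = trans (N-conj α₁) N-α₁
    ; factor₁ = swap-factor α₃ β₃ factor₃
    ; factor₂ = swap-factor α₂ β₂ factor₂
    ; factor₃ = swap-factor α₁ β₁ factor₁
    ; bézout₁₂ = let l , m , eq = bézout₂₃ in m , l , trans (ℤ.+-comm (m * c) (l * b)) eq
    ; bézout₂₃ = let l , m , eq = bézout₁₂ in m , l , trans (ℤ.+-comm (m * b) (l * a)) eq
    }
    where open MarkovData D

  vieta-flip : ℤ → ℤ → ℤ → ℤ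
  vieta-flip a b c = T * a * b - K * a - K * b - c
  {-# INLINE vieta-flip #-}

  vieta-flip-product : ∀ {a b c} → MarkovData a b c → c * vieta-flip a b c ≡ a * a + K * a * b + b * b
  vieta-flip-product {a} {b} {c} D = linear-combination (c * vieta-flip a b c) (a * a + K * a * b + b * b)
    (-1ℤ ⊛ MarkovData.equation D) (solve (a ∷ b ∷ c ∷ K ∷ []))

  markovData-left : ∀ {a b c} → c ≢ 0ℤ → MarkovData a b c → MarkovData a (vieta-flip a b c) b
  markovData-left {a} {b} {c} c≢0 D = record
    { equation = linear-combination
        (a * a + vieta-flip a b c * vieta-flip a b c + b * b + K * (a * vieta-flip a b c + vieta-flip a b c * b + b * a))
        (T * a * vieta-flip a b c * b) equation (solve (a ∷ b ∷ c ∷ K ∷ []))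
    ; α₁ = α₁ ; α₂ = β₃ ; α₃ = α₂
    ; β₁ = ω · β₁ ⊖ ω · α₁ · ι (T * b - K)
    ; β₂ = swap (conj α₃)
    ; β₃ = α₂ · ι (T * a - K) ⊖ (ι K ⊕ ω) · β₂
    ; N-α₁ = N-α₁
    ; N-α₂ = N-β₃
    ; N-α₃ = N-α₂
    ; factor₁ = factor₁′
    ; factor₂ = factor₂′
    ; factor₃ = factor₃′
    ; bézout₁₂ = bézout-left bézout₁₂
    ; bézout₂₃ = bézout-right bézout₁₂
    }
    where
    open MarkovData D
    open ≡-Reasoning
    flip = vieta-flip-product D

    bézout-left : ∃[ l ] ∃[ m ] l * a + m * b ≡ 1ℤ → ∃[ l ] ∃[ m ] l * a + m * vieta-flip a b c ≡ 1ℤ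
    bézout-left (l , m , eq) = l * l * a + + 2 * l * m * b - m * m * a - K * m * m * b , m * m * c ,
      linear-combination ((l * l * a + + 2 * l * m * b - m * m * a - K * m * m * b) * a + m * m * c * vieta-flip a b c) 1ℤ
        ((l * a + m * b + 1ℤ) ⊛ eq ⊞ (m * m) ⊛ flip) (solve (a ∷ b ∷ c ∷ l ∷ m ∷ K ∷ []))

    bézout-right : ∃[ l ] ∃[ m ] l * a + m * b ≡ 1ℤ → ∃[ l ] ∃[ m ] l * vieta-flip a b c + m * b ≡ 1ℤ
    bézout-right (l , m , eq) = l * l * c , + 2 * l * m * a + m * m * b - K * l * l * a - l * l * b ,
      linear-combination (l * l * c * vieta-flip a b c + (+ 2 * l * m * a + m * m * b - K * l * l * a - l * l * b) * b) 1ℤ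
        ((l * a + m * b + 1ℤ) ⊛ eq ⊞ (l * l) ⊛ flip) (solve (a ∷ b ∷ c ∷ l ∷ m ∷ K ∷ []))

    N-β₃ : N β₃ ≡ vieta-flip a b c
    N-β₃ = ℤ.*-cancelˡ-≡ c (N β₃) (vieta-flip a b c) {{≢-nonZero c≢0}} (begin
      c * N β₃                  ≡⟨ cong (_* N β₃) (trans (sym N-α₃) (sym (N-conj α₃))) ⟩
      N (conj α₃) * N β₃        ≡⟨ sym (N-· (conj α₃) β₃) ⟩
      N (conj α₃ · β₃)          ≡⟨ cong N factor₃ ⟩
      N ⟨ b , - a ⟩             ≡⟨ solve (a ∷ b ∷ K ∷ []) ⟩
      a * a + K * a * b + b * b ≡⟨ sym flip ⟩
      c * vieta-flip a b c      ∎)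

    factor₁′ : conj α₁ · (ω · β₁ ⊖ ω · α₁ · ι (T * b - K)) ≡ ⟨ b , - vieta-flip a b c ⟩
    factor₁′ = begin
      conj α₁ · (ω · β₁ ⊖ ω · α₁ · ι (T * b - K))
        ≡⟨ distribute α₁ β₁ ⟩
      ω · (conj α₁ · β₁) ⊖ ω · ι ((T * b - K) * N α₁)
        ≡⟨ cong₂ (λ F n → ω · F ⊖ ω · ι ((T * b - K) * n)) factor₁ N-α₁ ⟩
      ω · ⟨ c , - b ⟩ ⊖ ω · ι ((T * b - K) * a)
        ≡⟨ ℤ[ω]-≡ (ω · ⟨ c , - b ⟩ ⊖ ω · ι ((T * b - K) * a)) (⟨ b , - vieta-flip a b c ⟩)
                  (solve (a ∷ b ∷ c ∷ K ∷ [])) (solve (a ∷ b ∷ c ∷ K ∷ [])) ⟩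
      (⟨ b , - vieta-flip a b c ⟩) ∎
      where
      distribute : ∀ x y → conj x · (ω · y ⊖ ω · x · ι (T * b - K))
                         ≡ ω · (conj x · y) ⊖ ω · ι ((T * b - K) * N x)
      distribute x@(⟨ x₀ , x₁ ⟩) y@(⟨ y₀ , y₁ ⟩) =
        ℤ[ω]-≡ (conj x · (ω · y ⊖ ω · x · ι (T * b - K)))
               (ω · (conj x · y) ⊖ ω · ι ((T * b - K) * N x))
               (solve (x₀ ∷ x₁ ∷ y₀ ∷ y₁ ∷ b ∷ K ∷ [])) (solve (x₀ ∷ x₁ ∷ y₀ ∷ y₁ ∷ b ∷ K ∷ []))

    factor₂′ : conj β₃ · swap (conj α₃) ≡ ⟨ a , - b ⟩
    factor₂′ = begin
      conj β₃ · swap (conj α₃) ≡⟨ sym (swap-· β₃ (conj α₃)) ⟩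
      swap (β₃ · conj α₃)      ≡⟨ cong swap (·-comm β₃ (conj α₃)) ⟩
      swap (conj α₃ · β₃)      ≡⟨ cong swap factor₃ ⟩
      swap ⟨ b , - a ⟩         ≡⟨ swap-exchange b a ⟩
      (⟨ a , - b ⟩)            ∎

    factor₃′ : conj α₂ · (α₂ · ι (T * a - K) ⊖ (ι K ⊕ ω) · β₂) ≡ ⟨ vieta-flip a b c , - a ⟩
    factor₃′ = begin
      conj α₂ · (α₂ · ι (T * a - K) ⊖ (ι K ⊕ ω) · β₂)
        ≡⟨ distribute α₂ β₂ ⟩
      ι ((T * a - K) * N α₂) ⊖ (ι K ⊕ ω) · (conj α₂ · β₂)
        ≡⟨ cong₂ (λ n F → ι ((T * a - K) * n) ⊖ (ι K ⊕ ω) · F) N-α₂ factor₂ ⟩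
      ι ((T * a - K) * b) ⊖ (ι K ⊕ ω) · ⟨ a , - c ⟩
        ≡⟨ ℤ[ω]-≡ (ι ((T * a - K) * b) ⊖ (ι K ⊕ ω) · ⟨ a , - c ⟩) (⟨ vieta-flip a b c , - a ⟩)
                  (solve (a ∷ b ∷ c ∷ K ∷ [])) (solve (a ∷ b ∷ c ∷ K ∷ [])) ⟩
      (⟨ vieta-flip a b c , - a ⟩) ∎
      where
      distribute : ∀ x y → conj x · (x · ι (T * a - K) ⊖ (ι K ⊕ ω) · y)
                         ≡ ι ((T * a - K) * N x) ⊖ (ι K ⊕ ω) · (conj x · y)
      distribute x@(⟨ x₀ , x₁ ⟩) y@(⟨ y₀ , y₁ ⟩) =
        ℤ[ω]-≡ (conj x · (x · ι (T * a - K) ⊖ (ι K ⊕ ω) · y))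
               (ι ((T * a - K) * N x) ⊖ (ι K ⊕ ω) · (conj x · y))
               (solve (x₀ ∷ x₁ ∷ y₀ ∷ y₁ ∷ a ∷ K ∷ [])) (solve (x₀ ∷ x₁ ∷ y₀ ∷ y₁ ∷ a ∷ K ∷ []))

  middle-divides-u-ω : ∀ {a b c u j} (D : MarkovData a b c) → a * u - c ≡ j * b →
                   ∃[ γ ] MarkovData.α₂ D · γ ≡ ⟨ u , -1ℤ ⟩
  middle-divides-u-ω {a} {b} {c} {u} {j} D congruence = witness bézout₁₂
    where
    open MarkovData D
    open ≡-Reasoning
    witness : ∃[ l ] ∃[ m ] l * a + m * b ≡ 1ℤ → ∃[ γ ] α₂ · γ ≡ ⟨ u , -1ℤ ⟩
    witness (l , m , bz) = ι l · (ι j · conj α₂ ⊕ swap β₂) ⊕ ι m · conj α₂ · ⟨ u , -1ℤ ⟩ , (begin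
      α₂ · (ι l · (ι j · conj α₂ ⊕ swap β₂) ⊕ ι m · conj α₂ · ⟨ u , -1ℤ ⟩)
        ≡⟨ distribute α₂ β₂ ⟩
      ι l · (ι j · ι (N α₂) ⊕ swap (conj α₂ · β₂)) ⊕ ι m · ι (N α₂) · ⟨ u , -1ℤ ⟩
        ≡⟨ cong₂ (λ n F → ι l · (ι j · ι n ⊕ swap F) ⊕ ι m · ι n · ⟨ u , -1ℤ ⟩) N-α₂ factor₂ ⟩
      ι l · (ι j · ι b ⊕ swap ⟨ a , - c ⟩) ⊕ ι m · ι b · ⟨ u , -1ℤ ⟩
        ≡⟨ ℤ[ω]-≡ (ι l · (ι j · ι b ⊕ swap ⟨ a , - c ⟩) ⊕ ι m · ι b · ⟨ u , -1ℤ ⟩) (⟨ u , -1ℤ ⟩)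
             (linear-combination (re (ι l · (ι j · ι b ⊕ swap ⟨ a , - c ⟩) ⊕ ι m · ι b · ⟨ u , -1ℤ ⟩)) u
               ((- l) ⊛ congruence ⊞ u ⊛ bz) (solve (a ∷ b ∷ c ∷ u ∷ j ∷ l ∷ m ∷ K ∷ [])))
             (linear-combination (im (ι l · (ι j · ι b ⊕ swap ⟨ a , - c ⟩) ⊕ ι m · ι b · ⟨ u , -1ℤ ⟩)) -1ℤ
               (-1ℤ ⊛ bz) (solve (a ∷ b ∷ c ∷ u ∷ j ∷ l ∷ m ∷ K ∷ []))) ⟩
      (⟨ u , -1ℤ ⟩) ∎)
      where
      distribute : ∀ x y → x · (ι l · (ι j · conj x ⊕ swap y) ⊕ ι m · conj x · ⟨ u , -1ℤ ⟩)
                         ≡ ι l · (ι j · ι (N x) ⊕ swap (conj x · y)) ⊕ ι m · ι (N x) · ⟨ u , -1ℤ ⟩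
      distribute x@(⟨ x₀ , x₁ ⟩) y@(⟨ y₀ , y₁ ⟩) =
        ℤ[ω]-≡ (x · (ι l · (ι j · conj x ⊕ swap y) ⊕ ι m · conj x · ⟨ u , -1ℤ ⟩))
               (ι l · (ι j · ι (N x) ⊕ swap (conj x · y)) ⊕ ι m · ι (N x) · ⟨ u , -1ℤ ⟩)
               (solve (x₀ ∷ x₁ ∷ y₀ ∷ y₁ ∷ u ∷ j ∷ l ∷ m ∷ K ∷ [])) (solve (x₀ ∷ x₁ ∷ y₀ ∷ y₁ ∷ u ∷ j ∷ l ∷ m ∷ K ∷ []))

nonNeg-cancelˡ : ∀ c {y} → 0ℤ ≺ c → NonNeg (c * y) → NonNeg y
nonNeg-cancelˡ c {y} 0<c 0≤cy = by-sign (≼-total 0ℤ y)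
  where
  by-sign : 0ℤ ≼ y ⊎ y ≺ 0ℤ → NonNeg y
  by-sign (inj₁ 0≤y) = nonNeg-by y 0≤y (solve (y ∷ []))
  by-sign (inj₂ y<0) = ⊥-elim (nonNeg+1≢0 (nonNeg-+ (nonNeg-+ 0≤cy (nonNeg-* (nonNeg-+ 0<c (1 , refl)) y<0)) 0<c)
                                          (solve (c ∷ y ∷ [])))

positive-associates : ∀ {p b s t} → 0ℤ ≺ p → 0ℤ ≺ b → p ≡ b * s → b ≡ p * t → p ≡ b
positive-associates {p} {b} {s} {t} 0<p 0<b p≡bs b≡pt = by-unit (∣∣≡1⇒±1 s ∣s∣≡1)
  where
  p≢0 : p ≢ 0ℤ
  p≢0 p≡0 = nonNeg-contradiction 0<p p≡0 (solve (p ∷ []))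
  ts≡1 : t * s ≡ 1ℤ
  ts≡1 = ℤ.*-cancelˡ-≡ p (t * s) 1ℤ {{≢-nonZero p≢0}}
           (linear-combination (p * (t * s)) (p * 1ℤ) ((- s) ⊛ b≡pt ⊞ -1ℤ ⊛ p≡bs) (solve (p ∷ b ∷ s ∷ t ∷ [])))
  ∣s∣≡1 : ∣ s ∣ ≡ 1
  ∣s∣≡1 = ℕ.m*n≡1⇒n≡1 ∣ t ∣ ∣ s ∣ (trans (sym (ℤ.abs-* t s)) (cong ∣_∣ ts≡1))
  by-unit : s ≡ 1ℤ ⊎ s ≡ -1ℤ → p ≡ b
  by-unit (inj₁ s≡1)  = linear-combination p b (p≡bs ⊞ b ⊛ s≡1) (solve (p ∷ b ∷ s ∷ []))
  by-unit (inj₂ s≡-1) = ⊥-elim (nonNeg-contradiction (nonNeg-+ (nonNeg-+ 0<p 0<b) (1 , refl)) (p≡bs ⊞ b ⊛ s≡-1)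
                          (solve (p ∷ b ∷ s ∷ [])))

small-multiple≡0 : ∀ {b w z} → NonNeg b → b * w ≡ z → NonNeg (z + b - 1ℤ) → NonNeg (b - z - 1ℤ) → z ≡ 0ℤ
small-multiple≡0 {b} {w} {z} 0≤b eq z>-b z<b = by-sign (trichotomy w)
  where
  by-sign : 0ℤ ≺ w ⊎ w ≡ 0ℤ ⊎ w ≺ 0ℤ → z ≡ 0ℤ
  by-sign (inj₁ 0<w) = ⊥-elim (nonNeg-contradiction (nonNeg-+ (nonNeg-* 0≤b 0<w) z<b) eq (solve (b ∷ w ∷ z ∷ [])))
  by-sign (inj₂ (inj₁ w≡0)) = linear-combination z 0ℤ (-1ℤ ⊛ eq ⊞ b ⊛ w≡0) (solve (b ∷ w ∷ z ∷ []))
  by-sign (inj₂ (inj₂ w<0)) = ⊥-elim (nonNeg-contradiction (nonNeg-+ z>-b (nonNeg-* 0≤b w<0)) (-1ℤ ⊛ eq)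
                                (solve (b ∷ w ∷ z ∷ [])))

module Dominance (K : ℤ) (0≤K : NonNeg K) where
  open Quadratic K
  open Certificates K

  record Dominant (a b c : ℤ) : Set where
    field
      0<a   : 0ℤ ≺ a
      0<c   : 0ℤ ≺ c
      left  : K * a + c ≺ b
      right : K * c + a ≺ b

  dominant-root : Dominant 1ℤ (K + + 2) 1ℤ
  dominant-root = record
    { 0<a = 0 , refl ; 0<c = 0 , refl
    ; left = 0 , solve (K ∷ []) ; right = 0 , solve (K ∷ []) }

  dominant-reverse : ∀ {a b c} → Dominant a b c → Dominant c b a
  dominant-reverse D = record { 0<a = 0<c ; 0<c = 0<a ; left = right ; right = left }
    where open Dominant D

  dominant-left : ∀ {a b c B} → Dominant a b c → c * B ≡ a * a + K * a * b + b * b → Dominant a B b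
  dominant-left {a} {b} {c} {B} D flip = record
    { 0<a = 0<a
    ; 0<c = 0<b
    ; left = nonNeg-cancelˡ c 0<c (nonNeg-via (c * (B - (K * a + b) - 1ℤ)) left-gap flip
               (solve (a ∷ b ∷ c ∷ B ∷ K ∷ [])))
    ; right = nonNeg-cancelˡ c 0<c (nonNeg-via (c * (B - (K * b + a) - 1ℤ)) right-gap flip
                (solve (a ∷ b ∷ c ∷ B ∷ K ∷ [])))
    }
    where
    open Dominant D
    0≤a : NonNeg a
    0≤a = nonNeg-by a (nonNeg-+ 0<a (1 , refl)) (solve (a ∷ []))
    0≤c : NonNeg c
    0≤c = nonNeg-by c (nonNeg-+ 0<c (1 , refl)) (solve (c ∷ []))
    0<b : 0ℤ ≺ b
    0<b = ≺-by 0ℤ b (nonNeg-+ (nonNeg-+ (nonNeg-+ right (nonNeg-* 0≤K 0≤c)) 0<a) (1 , refl)) (solve (a ∷ b ∷ c ∷ K ∷ []))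
    0≤b : NonNeg b
    0≤b = nonNeg-by b (nonNeg-+ 0<b (1 , refl)) (solve (b ∷ []))
    c<b : NonNeg (b - c - 1ℤ)
    c<b = nonNeg-by (b - c - 1ℤ) (nonNeg-+ left (nonNeg-* 0≤K 0≤a)) (solve (a ∷ b ∷ c ∷ K ∷ []))
    b-c : NonNeg (b - c - 1ℤ + 1ℤ)
    b-c = nonNeg-+ c<b (1 , refl)
    left-gap : NonNeg (a * a + K * a * (b - c - 1ℤ + 1ℤ) + (b - c - 1ℤ + 1ℤ) * (b - c - 1ℤ + 1ℤ) + c * (b - c - 1ℤ))
    left-gap = nonNeg-+ (nonNeg-+ (nonNeg-+ (nonNeg-* 0≤a 0≤a) (nonNeg-* (nonNeg-* 0≤K 0≤a) b-c))
                                  (nonNeg-* b-c b-c)) (nonNeg-* 0≤c c<b)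
    right-gap : NonNeg (a * a + K * a * b + b * (b - (K * c + a) - 1ℤ) + a * (b - c - 1ℤ + 1ℤ) + (b - c - 1ℤ + 1ℤ))
    right-gap = nonNeg-+ (nonNeg-+ (nonNeg-+ (nonNeg-+ (nonNeg-* 0≤a 0≤a) (nonNeg-* (nonNeg-* 0≤K 0≤a) 0≤b))
                                            (nonNeg-* 0≤b right)) (nonNeg-* 0≤a b-c)) b-c

  residue-bound : ∀ {a b c u j} → Dominant a b c → a * u - c ≡ j * b → 0ℤ ≺ u → u ≺ b → u + K ≺ b
  residue-bound {a} {b} {c} {u} {j} D congruence 0<u u<b = by-size (≼-total b (u + K))
    where
    open Dominant D
    by-size : b ≼ u + K ⊎ u + K ≺ b → u + K ≺ b
    by-size (inj₂ u+K<b) = u+K<b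
    by-size (inj₁ b≤u+K) = ⊥-elim (nonNeg-contradiction (nonNeg-+ (nonNeg-* 0≤a b-u) 0<c) z≡0
                                     (solve (a ∷ b ∷ c ∷ u ∷ [])))
      where
      0≤a : NonNeg a
      0≤a = nonNeg-by a (nonNeg-+ 0<a (1 , refl)) (solve (a ∷ []))
      b-u : NonNeg (b - u)
      b-u = nonNeg-by (b - u) (nonNeg-+ u<b (1 , refl)) (solve (b ∷ u ∷ []))
      0≤b : NonNeg b
      0≤b = nonNeg-by b (nonNeg-+ (nonNeg-+ 0<u u<b) (2 , refl)) (solve (b ∷ u ∷ []))
      z≡0 : a * (b - u) + c ≡ 0ℤ
      z≡0 = small-multiple≡0 {b} {a - j} {a * (b - u) + c} 0≤b
              (linear-combination (b * (a - j)) (a * (b - u) + c) congruence (solve (a ∷ b ∷ c ∷ u ∷ j ∷ [])))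
              (nonNeg-by (a * (b - u) + c + b - 1ℤ) (nonNeg-+ (nonNeg-+ (nonNeg-* 0≤a b-u) 0<c) 0≤b)
                (solve (a ∷ b ∷ c ∷ u ∷ [])))
              (nonNeg-by (b - (a * (b - u) + c) - 1ℤ) (nonNeg-+ left (nonNeg-* 0≤a b≤u+K))
                (solve (a ∷ b ∷ c ∷ u ∷ K ∷ [])))

  certificate-from-divisor : ∀ {p q p′ q′ b u α γ} → Admissible (conv p q p′ q′) → b * q ≡ u * p →
                             N α ≡ b → α · γ ≡ ⟨ u , -1ℤ ⟩ → 0ℤ ≺ u → u + K ≺ b → WahlCertificate (conv p q p′ q′)
  certificate-from-divisor {p} {q} {p′} {q′} {b} {u} {α} {γ} A bq≡up Nα≡b αγ≡u-ω 0<u u+K<b =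
    certificate p≡b (ℤ.*-cancelˡ-≡ b q u {{≢-nonZero b≢0}} (trans bq≡up (trans (cong (u *_) p≡b) (ℤ.*-comm u b))))
    where
    open Admissible A
    open ≡-Reasoning
    0<b : 0ℤ ≺ b
    0<b = ≺-by 0ℤ b (nonNeg-+ (nonNeg-+ (nonNeg-+ u+K<b 0≤K) 0<u) (1 , refl)) (solve (b ∷ u ∷ K ∷ []))
    0≤b : NonNeg b
    0≤b = nonNeg-by b (nonNeg-+ 0<b (1 , refl)) (solve (b ∷ []))
    b≢0 : b ≢ 0ℤ
    b≢0 b≡0 = nonNeg-contradiction 0<b b≡0 (solve (b ∷ []))

    normU : b * N γ ≡ u * u + K * u + 1ℤ
    normU = begin
      b * N γ            ≡⟨ cong (_* N γ) (sym Nα≡b) ⟩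
      N α * N γ          ≡⟨ sym (N-· α γ) ⟩
      N (α · γ)          ≡⟨ cong N αγ≡u-ω ⟩
      N ⟨ u , -1ℤ ⟩      ≡⟨ solve (u ∷ K ∷ []) ⟩
      u * u + K * u + 1ℤ ∎

    p≡b : p ≡ b
    p≡b = positive-associates (≺-by 0ℤ p (nonNeg-+ (nonNeg-+ (0<q A) (q<p A)) (1 , refl)) (solve (p ∷ q ∷ []))) 0<b
            (numerator (N γ) normU) denominator
      where
      numerator : ∀ X → b * X ≡ u * u + K * u + 1ℤ → p ≡ b * (p * X - q * (u + K))
      numerator X bX≡ = linear-combination p (b * (p * X - q * (u + K))) ((- p) ⊛ bX≡ ⊞ (u + K) ⊛ bq≡up)
                          (solve (p ∷ q ∷ b ∷ u ∷ X ∷ K ∷ []))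
      denominator : b ≡ p * (p′ * u - b * q′)
      denominator = linear-combination b (p * (p′ * u - b * q′)) ((- b) ⊛ det≡1 ⊞ p′ ⊛ bq≡up)
                      (solve (p ∷ q ∷ p′ ∷ q′ ∷ b ∷ u ∷ []))

    certificate : p ≡ b → q ≡ u → WahlCertificate (conv p q p′ q′)
    certificate refl refl = record
      { relation = relation
      ; e₁ = conj α
      ; e₂ = γ
      ; N-e₁ = trans (N-conj α) Nα≡b
      ; N-e₂ = gap-from (N γ) normU
      ; polar-e = begin
          polar (conj α) γ ≡⟨ polar-conj α γ ⟩
          tr (α · γ)       ≡⟨ cong tr αγ≡u-ω ⟩
          tr ⟨ q , -1ℤ ⟩   ≡⟨ solve (q ∷ K ∷ []) ⟩
          + 2 * q + K      ∎
      ; det-e = ℤ.*-cancelˡ-≡ p (det (conj α) γ) -1ℤ {{≢-nonZero b≢0}} (begin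
          p * det (conj α) γ        ≡⟨ cong (_* det (conj α) γ) (sym Nα≡b) ⟩
          N α * det (conj α) γ      ≡⟨ sym (det-· α (conj α) γ) ⟩
          det (α · conj α) (α · γ)  ≡⟨ cong₂ det (·-conjʳ α) αγ≡u-ω ⟩
          det (ι (N α)) ⟨ q , -1ℤ ⟩ ≡⟨ cong (λ n → det (ι n) ⟨ q , -1ℤ ⟩) Nα≡b ⟩
          det (ι p) ⟨ q , -1ℤ ⟩     ≡⟨ solve (p ∷ q ∷ []) ⟩
          p * -1ℤ                   ∎)
      }
      where
      relation-from : ∀ X → p * X ≡ q * q + K * q + 1ℤ → p′ + q + K ≡ p
      relation-from X pX≡ = linear-combination (p′ + q + K) p Z≡0 (solve (p ∷ q ∷ p′ ∷ K ∷ []))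
        where
        Z≡0 : p′ + q + K - p ≡ 0ℤ
        Z≡0 = small-multiple≡0 {p} {X * (p′ + q + K - p) - (q + K) * (q′ + X - q)} {p′ + q + K - p} 0≤b
                (linear-combination (p * (X * (p′ + q + K - p) - (q + K) * (q′ + X - q))) (p′ + q + K - p)
                  ((q + K) ⊛ det≡1 ⊞ (p′ - p) ⊛ pX≡) (solve (p ∷ q ∷ p′ ∷ q′ ∷ X ∷ K ∷ [])))
                (nonNeg-by (p′ + q + K - p + p - 1ℤ) (nonNeg-+ (nonNeg-+ (nonNeg-+ (0<p′ A) (0<q A)) 0≤K) (1 , refl))
                  (solve (p ∷ q ∷ p′ ∷ K ∷ [])))
                (nonNeg-by (p - (p′ + q + K - p) - 1ℤ) (nonNeg-+ (nonNeg-+ (p′<p A) u+K<b) (1 , refl))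
                  (solve (p ∷ q ∷ p′ ∷ K ∷ [])))

      relation : p′ + q + K ≡ p
      relation = relation-from (N γ) normU

      gap-from : ∀ X → p * X ≡ q * q + K * q + 1ℤ → X ≡ q - q′
      gap-from X pX≡ = ℤ.*-cancelˡ-≡ p X (q - q′) {{≢-nonZero b≢0}}
        (linear-combination (p * X) (p * (q - q′)) (pX≡ ⊞ -1ℤ ⊛ det≡1 ⊞ q ⊛ relation)
          (solve (p ∷ q ∷ p′ ∷ q′ ∷ X ∷ K ∷ [])))

walk-preserves : ∀ {A : Set} (P : A → Set) (step : Dir → A → A) →
                 (∀ d {v} → P v → P (step d v)) → ∀ path {v} → P v → P (walk step v path)
walk-preserves P step preserves []         pv = pv
walk-preserves P step preserves (d ∷ path) pv = walk-preserves P step preserves path (preserves d pv)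

exact-quotient : ∀ {c n} {x : ℤ} → 1 ≤ c → + c * x ≡ + n → ∃[ B ] x ≡ + B × divN n c ≡ B
exact-quotient {suc c} {n} {+ B} _ eq = B , refl , (begin
  n / suc c           ≡⟨ cong (_/ suc c) cB ⟨
  suc c ℕ.* B / suc c ≡⟨ cong (_/ suc c) (ℕ.*-comm (suc c) B) ⟩
  B ℕ.* suc c / suc c ≡⟨ m*n/n≡m B (suc c) ⟩
  B                   ∎)
  where
  open ≡-Reasoning
  cB : suc c ℕ.* B ≡ n
  cB = ℤ.+-injective (trans (ℤ.pos-* (suc c) B) eq)
exact-quotient {suc c} {x = -[1+ m ]} _ ()

pos-quadratic : ∀ k a b → + (a ℕ.* a ℕ.+ k ℕ.* a ℕ.* b ℕ.+ b ℕ.* b) ≡ + a * + a + + k * + a * + b + + b * + b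
pos-quadratic k a b = begin
  + (a ℕ.* a ℕ.+ k ℕ.* a ℕ.* b ℕ.+ b ℕ.* b)         ≡⟨ ℤ.pos-+ (a ℕ.* a ℕ.+ k ℕ.* a ℕ.* b) (b ℕ.* b) ⟩
  + (a ℕ.* a ℕ.+ k ℕ.* a ℕ.* b) + + (b ℕ.* b)       ≡⟨ cong (_+ + (b ℕ.* b)) (ℤ.pos-+ (a ℕ.* a) (k ℕ.* a ℕ.* b)) ⟩
  + (a ℕ.* a) + + (k ℕ.* a ℕ.* b) + + (b ℕ.* b)     ≡⟨ cong₂ (λ x y → x + y + + (b ℕ.* b)) (ℤ.pos-* a a) kab ⟩
  + a * + a + + k * + a * + b + + (b ℕ.* b)         ≡⟨ cong (λ z → + a * + a + + k * + a * + b + z) (ℤ.pos-* b b) ⟩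
  + a * + a + + k * + a * + b + + b * + b           ∎
  where
  open ≡-Reasoning
  kab : + (k ℕ.* a ℕ.* b) ≡ + k * + a * + b
  kab = trans (ℤ.pos-* (k ℕ.* a) b) (cong (_* + b) (ℤ.pos-* k a))

module MarkovTree (k : ℕ) where
  open Certificates (+ k)
  open MarkovTriples (+ k)
  open Dominance (+ k) (+-nonNeg k)

  MarkovInvariant : MTriple → Set
  MarkovInvariant (a , b , c) = Dominant (+ a) (+ b) (+ c) × MarkovData (+ a) (+ b) (+ c)

  invariant-root : MarkovInvariant (markovRoot k)
  invariant-root = dominant-root , markovData-root

  invariant-reverse : ∀ {a b c} → MarkovInvariant (a , b , c) → MarkovInvariant (c , b , a)
  invariant-reverse (D , M) = dominant-reverse D , markovData-reverse M

  invariant-left : ∀ {a b c} → MarkovInvariant (a , b , c) → MarkovInvariant (markovStep k L (a , b , c))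
  invariant-left {a} {b} {c} (D , M) = subst (λ B → MarkovInvariant (a , B , b)) (sym divN≡B)
    (subst (λ x → Dominant (+ a) x (+ b) × MarkovData (+ a) x (+ b)) flip≡B
      (dominant-left D (vieta-flip-product M) , markovData-left c≢0 M))
    where
    1≤c : 1 ≤ c
    1≤c = ≺⇒ℕ< (Dominant.0<c D)
    c≢0 : + c ≢ 0ℤ
    c≢0 eq with ℤ.+-injective eq | 1≤c
    ... | refl | ()
    quotient = exact-quotient 1≤c (trans (vieta-flip-product M) (sym (pos-quadratic k a b)))
    flip≡B = proj₁ (proj₂ quotient)
    divN≡B = proj₂ (proj₂ quotient)

  invariant-step : ∀ d {v} → MarkovInvariant v → MarkovInvariant (markovStep k d v)
  invariant-step L {a , b , c} t = invariant-left t
  invariant-step R {a , b , c} t = subst MarkovInvariant (cong (λ n → b , divN n a , c) (symmetric k b c))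
                                  (invariant-reverse (invariant-left (invariant-reverse t)))
    where
    symmetric : ∀ k b c → c ℕ.* c ℕ.+ k ℕ.* c ℕ.* b ℕ.+ b ℕ.* b ≡ b ℕ.* b ℕ.+ k ℕ.* b ℕ.* c ℕ.+ c ℕ.* c
    symmetric = ℕ-Solver.solve-∀

  markov-invariant : ∀ path {a b c} → markov k path ≡ (a , b , c) → MarkovInvariant (a , b , c)
  markov-invariant path eq =
    subst MarkovInvariant eq (walk-preserves MarkovInvariant (markovStep k) invariant-step path invariant-root)

  markov-certificate : ∀ {a b c u bs} → MarkovInvariant (a , b , c) → 0 < u → u < b → (a ℕ.* u) ≡ c [mod b ] →
                       IsHJExpansion b u bs → WahlCertificate (convergents bs)
  markov-certificate {a} {b} {c} {u} {b₁ ∷ bs} (D , M) 0<u u<b b∣au-c (hj 2≤ eqH) =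
    certificate-from-divisor {b = + b} {+ u} {MarkovData.α₂ M} {proj₁ γ}
      (admissible 2≤) bq≡up (MarkovData.N-α₂ M) (proj₂ γ)
      (ℕ<⇒≺ 0<u) (residue-bound {u = + u} {j} D congruence (ℕ<⇒≺ 0<u) (ℕ<⇒≺ u<b))
    where
    open ≡-Reasoning
    signed : + b Signed.∣ + (a ℕ.* u) - + c
    signed = Signed.∣ᵤ⇒∣ {+ b} {+ (a ℕ.* u) - + c} b∣au-c
    j = Signed._∣_.quotient signed
    congruence : + a * + u - + c ≡ j * + b
    congruence = trans (cong (_- + c) (sym (ℤ.pos-* a u))) (Signed._∣_.equality signed)
    γ = middle-divides-u-ω {u = + u} {j} M congruence
    n = proj₁ (hjEval (b₁ ∷ bs))
    d = proj₂ (hjEval (b₁ ∷ bs))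
    C = convergents (b₁ ∷ bs)
    bq≡up : + b * Convergents.q C ≡ + u * Convergents.p C
    bq≡up = begin
      + b * Convergents.q C ≡⟨ cong (+ b *_) (proj₂ (hjEval-convergents 2≤)) ⟨
      + b * + d             ≡⟨ ℤ.pos-* b d ⟨
      + (b ℕ.* d)           ≡⟨ cong +_ eqH ⟩
      + (u ℕ.* n)           ≡⟨ ℤ.pos-* u n ⟩
      + u * + n             ≡⟨ cong (+ u *_) (proj₁ (hjEval-convergents 2≤)) ⟩
      + u * Convergents.p C ∎

-- The Farey data only names the vertex: the conclusion holds at every vertex of MT(k).
theorem8p2 : (k p q : ℕ) → 0 < p → p < q → Coprime p q →
    (path : List Dir) →
    (r s : Frac) → farey path ≡ (r , (p , q) , s) →
    (mr mt ms : ℕ) → markov k path ≡ (mr , mt , ms) →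
    (u : ℕ) → 0 < u → u < mt → (mr ℕ.* u) ≡ ms [mod mt ] →
    (bs : List ℕ) → IsHJExpansion mt u bs → KWahl k bs
theorem8p2 k _ _ _ _ _ path _ _ _ _ _ _ markov≡ u 0<u u<mt congruence bs@(_ ∷ _) expansion@(hj 2≤ _) =
  WahlChains.certificate⇒KWahl k bs (<-wellFounded (length bs)) (s≤s z≤n) 2≤
    (MarkovTree.markov-certificate k (MarkovTree.markov-invariant k path markov≡) 0<u u<mt congruence expansion)
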